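{- Let $t\ge6$ be an integer and let $\lambda\in\mathcal{DS}(t)$ satisfy $|\lambda|=\max\{|\mu|:\mu\in\mathcal{DS}(t)\}$. Write $MD(\lambda)=\{h_1>h_2>\dots>h_k\}$ and $d_i=h_i-h_{i+1}$ for $1\le i\le k-1$. Then $4\le d_i\le 6$ for every $1\le i\le k-1$.
   Context: Hook length of box $(i,j)$ of a Young diagram: number of boxes to its right in row $i$, plus number below it in column $j$, plus one. A partition is a $t$-core if no hook length is divisible by $t$; a $(t,t+1)$-core if it is both a $t$-core and a $(t+1)$-core. Self-conjugate: Young diagram symmetric about the main diagonal. $|\lambda|$ is the sum of the parts. $s(\lambda)$ is the largest $s$ such that $\lambda$ has at least $s$ parts $\ge s$. $MD(\lambda)$ is the set of hook lengths of the main-diagonal boxes $(i,i)$, $1\le i\le s(\lambda)$ (these are distinct odd numbers). $\mathcal{DS}(t)$ is the set of self-conjugate $(t,t+1)$-core partitions whose first $s(\lambda)$ parts are pairwise distinct, including the empty partition. -}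

module Defs where

open import Data.Nat using (ℕ; zero; suc; _+_; _∸_; _≤_; _<_; _≤?_)
open import Data.Nat.Divisibility using (_∣_)
open import Data.List using (List; []; _∷_; length; filter)
open import Data.Nat.ListAction using (sum)
open import Data.List.Relation.Unary.All using (All)
open import Data.List.Relation.Unary.Linked using (Linked)
open import Data.Product using (Σ; _×_; _,_)
open import Relation.Nullary using (¬_; yes; no)
open import Relation.Binary.PropositionalEquality using (_≡_; _≢_)

IsPartition : List ℕ → Set
IsPartition λ′ = Linked (λ a b → b ≤ a) λ′ × All (λ x → 1 ≤ x) λ′

-- part λ i = λ_i (1-indexed), 0 if i = 0 or i > number of parts.
part : List ℕ → ℕ → ℕ
part []       _             = 0
part (x ∷ xs) zero          = 0
part (x ∷ xs) (suc zero)    = x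
part (x ∷ xs) (suc (suc i)) = part xs (suc i)

conj : List ℕ → ℕ → ℕ
conj λ′ j = length (filter (j ≤?_) λ′)

size : List ℕ → ℕ
size = sum

Box : List ℕ → ℕ → ℕ → Set
Box λ′ i j = 1 ≤ i × 1 ≤ j × j ≤ part λ′ i

-- hook length of box (i,j): arm + leg + 1
hook : List ℕ → ℕ → ℕ → ℕ
hook λ′ i j = (part λ′ i ∸ j) + (conj λ′ j ∸ i) + 1

IsCore : ℕ → List ℕ → Set
IsCore t λ′ = ∀ i j → Box λ′ i j → ¬ (t ∣ hook λ′ i j)

SelfConj : List ℕ → Set
SelfConj λ′ = ∀ j → 1 ≤ j → conj λ′ j ≡ part λ′ j

durfeeUpTo : List ℕ → ℕ → ℕ
durfeeUpTo λ′ zero = zero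
durfeeUpTo λ′ (suc n) with suc n ≤? conj λ′ (suc n)
... | yes _ = suc n
... | no  _ = durfeeUpTo λ′ n

-- s(λ): largest s such that λ has at least s parts ≥ s
-- (any such s is ≤ the number of parts, so searching up to length λ suffices)
s : List ℕ → ℕ
s λ′ = durfeeUpTo λ′ (length λ′)

DistinctTop : List ℕ → Set
DistinctTop λ′ = ∀ i j → 1 ≤ i → i < j → j ≤ s λ′ → part λ′ i ≢ part λ′ j

_∈MD_ : ℕ → List ℕ → Set
h ∈MD λ′ = Σ ℕ (λ i → 1 ≤ i × i ≤ s λ′ × hook λ′ i i ≡ h)

DS : ℕ → List ℕ → Set
DS t λ′ = IsPartition λ′ × IsCore t λ′ × IsCore (suc t) λ′ × SelfConj λ′ × DistinctTop λ′

{-# OPTIONS --safe #-}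

-- A self-conjugate partition λ whose diagonal rows have distinct lengths is determined by its
-- set S of diagonal values λ_i − i + 1: the diagonal hooks have lengths 2u − 1 (u ∈ S), so
-- |λ| = Σ_{u ∈ S} (2u − 1). Every hook length of λ is u + v − 1 for some u, v ∈ S or smaller than
-- an element of S, and λ lies in DS(t) exactly when S ⊆ [1, t] contains no two consecutive numbers
-- and no u, v (possibly equal) with u + v ∈ {t + 1, t + 2}. That S ⊆ [1, t] holds because along
-- the first row the hook lengths fall from 2λ₁ − 1 to 1 without ever jumping from above t + 1 to
-- below t.
-- Consecutive diagonal hooks of a largest member of DS(t) come from consecutive elements v < u of S,
-- so they differ by 2(u − v) ≥ 4. If u ≥ v + 4, put c = u − 2: adding c and deleting its partners
-- t + 1 − c and t + 2 − c (if 2c ≥ t + 3), or else replacing v by v + 1 (if t − v ∉ S), or else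
-- replacing v and t − v by v + 2 and t − v + 1, gives an admissible set of larger weight.

module Submission where

open import Defs
open import Data.Bool using (Bool; true; false; if_then_else_)
open import Data.Bool.Properties using (¬-not; not-¬)
open import Data.Empty using (⊥; ⊥-elim)
open import Data.List using (List; []; _∷_; length; upTo)
open import Data.List.Membership.Propositional using (lose)
open import Data.List.Membership.Propositional.Properties using (∈-upTo⁺)
open import Data.List.Properties using (length-filter; filter-accept; filter-reject)
open import Data.List.Relation.Unary.All as All using (All; []; _∷_)
open import Data.List.Relation.Unary.Any using (any?; satisfied)
open import Data.List.Relation.Unary.Linked as Linked using (Linked; []; [-]; _∷_)
open import Data.List.Relation.Unary.Linked.Properties using (Linked⇒All)
open import Data.Nat
open import Data.Nat.Divisibility using (_∣_; divides-refl; ∣⇒≤; ∣-refl)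
open import Data.Nat.Induction using (<-rec)
open import Data.Nat.ListAction using (sum)
open import Data.Nat.Properties
open import Data.Nat.Tactic.RingSolver using (solve-∀)
open import Data.Product using (∃; _×_; _,_; proj₁; proj₂)
open import Data.Sum as Sum using (_⊎_; inj₁; inj₂; [_,_]′)
open import Function using (_∘_)
open import Relation.Binary using (tri<; tri≈; tri>)
open import Relation.Binary.PropositionalEquality
open import Relation.Nullary using (¬_; Dec; does; yes; no; contradiction; _×-dec_)
open import Relation.Nullary.Decidable using (dec-true)

-- Rows, columns and the diagonal

conj-∷-≤ : ∀ {j x} xs → j ≤ x → conj (x ∷ xs) j ≡ suc (conj xs j)
conj-∷-≤ {j} xs j≤x = cong length (filter-accept (j ≤?_) j≤x)

conj-∷-≰ : ∀ {j x} xs → j ≰ x → conj (x ∷ xs) j ≡ conj xs j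
conj-∷-≰ {j} xs j≰x = cong length (filter-reject (j ≤?_) j≰x)

conj≤length : ∀ xs j → conj xs j ≤ length xs
conj≤length xs j = length-filter (j ≤?_) xs

conj-all-< : ∀ {j} xs → All (_< j) xs → conj xs j ≡ 0
conj-all-< []       []         = refl
conj-all-< (x ∷ xs) (x<j ∷ ps) = trans (conj-∷-≰ xs (<⇒≱ x<j)) (conj-all-< xs ps)

part-all-≤ : ∀ {m} xs k → All (_≤ m) xs → part xs k ≤ m
part-all-≤ []       k             _          = z≤n
part-all-≤ (x ∷ xs) zero          _          = z≤n
part-all-≤ (x ∷ xs) (suc zero)    (x≤m ∷ _)  = x≤m
part-all-≤ (x ∷ xs) (suc (suc k)) (_ ∷ ps)   = part-all-≤ xs (suc k) ps

IsPartition-tail : ∀ {x xs} → IsPartition (x ∷ xs) → IsPartition xs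
IsPartition-tail ([-]     , _ ∷ pos) = [] , pos
IsPartition-tail (_ ∷ dec , _ ∷ pos) = dec , pos

head-bounds : ∀ {x xs} → Linked _≥_ (x ∷ xs) → All (_≤ x) xs
head-bounds [-]         = []
head-bounds (y≤x ∷ dec) = Linked⇒All (λ p q → ≤-trans q p) y≤x dec

conj-beyond-head : ∀ {x xs j} → IsPartition (x ∷ xs) → x < j → conj (x ∷ xs) j ≡ 0
conj-beyond-head {x} {xs} P x<j =
  conj-all-< (x ∷ xs) (x<j ∷ All.map (λ y≤x → ≤-<-trans y≤x x<j) (head-bounds (proj₁ P)))

part-≤-head : ∀ {x xs} → IsPartition (x ∷ xs) → ∀ k → part (x ∷ xs) k ≤ x
part-≤-head {x} {xs} P k = part-all-≤ (x ∷ xs) k (≤-refl ∷ head-bounds (proj₁ P))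

≤conj⇒≤part : ∀ {xs} → IsPartition xs → ∀ {k j} → suc k ≤ conj xs j → j ≤ part xs (suc k)
≤conj⇒≤part {[]}     _ ()
≤conj⇒≤part {x ∷ xs} P {k} {j} h with j ≤? x
... | no j≰x = contradiction (subst (suc k ≤_) (conj-beyond-head P (≰⇒> j≰x)) h) λ ()
≤conj⇒≤part {x ∷ xs} P {zero}  h | yes j≤x = j≤x
≤conj⇒≤part {x ∷ xs} P {suc k} {j} h | yes j≤x =
  ≤conj⇒≤part (IsPartition-tail P) (s≤s⁻¹ (subst (suc (suc k) ≤_) (conj-∷-≤ xs j≤x) h))

≤part⇒≤conj : ∀ {xs} → IsPartition xs → ∀ {k j} → 1 ≤ j → j ≤ part xs (suc k) → suc k ≤ conj xs j
≤part⇒≤conj {[]}     _ 1≤j j≤0 = contradiction j≤0 (<⇒≱ 1≤j)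
≤part⇒≤conj {x ∷ xs} P {zero}  _   j≤x = subst (1 ≤_) (sym (conj-∷-≤ xs j≤x)) (s≤s z≤n)
≤part⇒≤conj {x ∷ xs} P {suc k} 1≤j h   =
  subst (suc (suc k) ≤_) (sym (conj-∷-≤ xs (≤-trans h (part-≤-head P (suc (suc k))))))
        (s≤s (≤part⇒≤conj (IsPartition-tail P) 1≤j h))

part-anti : ∀ {xs} → IsPartition xs → ∀ {k l} → k ≤ l → part xs (suc l) ≤ part xs (suc k)
part-anti {[]}     _ _                 = z≤n
part-anti {x ∷ xs} P {zero} {l} _      = part-≤-head P (suc l)
part-anti {x ∷ xs} P {suc k} (s≤s k≤l) = part-anti (IsPartition-tail P) k≤l

durfee-≤-conj : ∀ xs n → durfeeUpTo xs n ≤ conj xs (durfeeUpTo xs n)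
durfee-≤-conj xs zero = z≤n
durfee-≤-conj xs (suc n) with suc n ≤? conj xs (suc n)
... | yes n<conj = n<conj
... | no  _      = durfee-≤-conj xs n

durfee-maximal : ∀ xs n {m} → durfeeUpTo xs n < m → m ≤ n → conj xs m < m
durfee-maximal xs zero    d<m m≤0 = contradiction m≤0 (<⇒≱ (≤-<-trans z≤n d<m))
durfee-maximal xs (suc n) {m} d<m m≤n with suc n ≤? conj xs (suc n)
... | yes _ = contradiction m≤n (<⇒≱ d<m)
... | no n≮conj with m≤n⇒m<n∨m≡n m≤n
...   | inj₁ m<1+n = durfee-maximal xs n d<m (s≤s⁻¹ m<1+n)
...   | inj₂ refl  = ≰⇒> n≮conj

-- Rows are counted from 0: OnDiagonal xs k says that (k+1, k+1) is a box.
OnDiagonal : List ℕ → ℕ → Set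
OnDiagonal xs k = suc k ≤ part xs (suc k)

-- λ_{k+1} − k; for self-conjugate λ the diagonal hook at (k+1, k+1) has length 2 diagValue − 1.
diagValue : List ℕ → ℕ → ℕ
diagValue xs k = part xs (suc k) ∸ k

module _ {xs : List ℕ} (P : IsPartition xs) where

  ≤s⇒onDiagonal : ∀ {k} → suc k ≤ s xs → OnDiagonal xs k
  ≤s⇒onDiagonal {k} k<s = ≤-trans k<s (below (s xs) k<s (durfee-≤-conj xs (length xs)))
    where
    below : ∀ d → suc k ≤ d → d ≤ conj xs d → d ≤ part xs (suc k)
    below (suc d) (s≤s k≤d) d≤conj = ≤-trans (≤conj⇒≤part P d≤conj) (part-anti P k≤d)

  onDiagonal⇒≤s : ∀ {k} → OnDiagonal xs k → suc k ≤ s xs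
  onDiagonal⇒≤s {k} diag with suc k ≤? s xs
  ... | yes k<s = k<s
  ... | no  k≮s = contradiction k<conj
                    (<⇒≱ (durfee-maximal xs (length xs) (≰⇒> k≮s) (≤-trans k<conj (conj≤length xs (suc k)))))
    where
    k<conj : suc k ≤ conj xs (suc k)
    k<conj = ≤part⇒≤conj P (s≤s z≤n) diag

  onDiagonal-down : ∀ {k l} → k ≤ l → OnDiagonal xs l → OnDiagonal xs k
  onDiagonal-down k≤l diag = ≤-trans (s≤s k≤l) (≤-trans diag (part-anti P k≤l))

  reaches-off-diagonal⇒onDiagonal : ∀ {k r} → ¬ OnDiagonal xs k → suc k ≤ part xs (suc r) → OnDiagonal xs r
  reaches-off-diagonal⇒onDiagonal {k} {r} off k<row with suc r ≤? part xs (suc r)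
  ... | yes diag = diag
  ... | no  r≮row = contradiction (≤-trans k<row (part-anti P k≤r)) off
    where
    k≤r : k ≤ r
    k≤r = <⇒≤ (≤-trans k<row (≮⇒≥ r≮row))

  diagonal-box : ∀ {k l} → OnDiagonal xs k → OnDiagonal xs l → suc l ≤ part xs (suc k)
  diagonal-box {k} {l} dk dl with l ≤? k
  ... | yes l≤k = ≤-trans (s≤s l≤k) dk
  ... | no  l≰k = ≤-trans dl (part-anti P (<⇒≤ (≰⇒> l≰k)))

part≡diagValue+k : ∀ {xs k} → OnDiagonal xs k → part xs (suc k) ≡ diagValue xs k + k
part≡diagValue+k diag = sym (m∸n+n≡m (≤-trans (n≤1+n _) diag))

same-diagValue⇒same-part : ∀ ys zs {k} → OnDiagonal ys k → OnDiagonal zs k → diagValue ys k ≡ diagValue zs k →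
                           part ys (suc k) ≡ part zs (suc k)
same-diagValue⇒same-part ys zs {k} dy dz same =
  trans (part≡diagValue+k {ys} dy) (trans (cong (_+ k) same) (sym (part≡diagValue+k {zs} dz)))

hook-selfConj : ∀ {xs} → SelfConj xs → ∀ i j → 1 ≤ j → hook xs i j ≡ (part xs i ∸ j) + (part xs j ∸ i) + 1
hook-selfConj {xs} SC i j 1≤j = cong (λ c → (part xs i ∸ j) + (c ∸ i) + 1) (SC j 1≤j)

box-transpose : ∀ {xs} → IsPartition xs → SelfConj xs → ∀ {i j} → Box xs i j → Box xs j i
box-transpose P SC {suc k} {suc l} (1≤i , 1≤j , j≤row) =
  1≤j , 1≤i , subst (suc k ≤_) (SC (suc l) 1≤j) (≤part⇒≤conj P 1≤j j≤row)

hook-transpose : ∀ {xs} → SelfConj xs → ∀ {i j} → 1 ≤ i → 1 ≤ j → hook xs j i ≡ hook xs i j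
hook-transpose {xs} SC {i} {j} 1≤i 1≤j =
  trans (hook-selfConj {xs} SC j i 1≤i)
        (trans (cong (_+ 1) (+-comm (part xs j ∸ i) (part xs i ∸ j))) (sym (hook-selfConj {xs} SC i j 1≤j)))

hook-diagonal : ∀ {xs} → IsPartition xs → SelfConj xs → ∀ {k l} → OnDiagonal xs k → OnDiagonal xs l →
                suc (hook xs (suc k) (suc l)) ≡ diagValue xs k + diagValue xs l
hook-diagonal {xs} P SC {k} {l} dk dl = +-cancelʳ-≡ (k + l) _ _ (begin
  suc (hook xs (suc k) (suc l)) + (k + l)
    ≡⟨ cong (λ h → suc h + (k + l)) (hook-selfConj {xs} SC (suc k) (suc l) (s≤s z≤n)) ⟩
  suc (A + B + 1) + (k + l)
    ≡⟨ regroup A B k l ⟩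
  (A + suc l) + (B + suc k)
    ≡⟨ cong₂ _+_ (m∸n+n≡m (diagonal-box P dk dl)) (m∸n+n≡m (diagonal-box P dl dk)) ⟩
  part xs (suc k) + part xs (suc l)
    ≡⟨ cong₂ _+_ (part≡diagValue+k {xs} dk) (part≡diagValue+k {xs} dl) ⟩
  (diagValue xs k + k) + (diagValue xs l + l)
    ≡⟨ +-assoc-middle (diagValue xs k) k (diagValue xs l) l ⟩
  diagValue xs k + diagValue xs l + (k + l) ∎)
  where
  open ≡-Reasoning
  A B : ℕ
  A = part xs (suc k) ∸ suc l
  B = part xs (suc l) ∸ suc k
  regroup : ∀ A B k l → suc (A + B + 1) + (k + l) ≡ (A + suc l) + (B + suc k)
  regroup = solve-∀
  +-assoc-middle : ∀ a k b l → (a + k) + (b + l) ≡ a + b + (k + l)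
  +-assoc-middle = solve-∀

module _ {D E : ℕ → Set} {a b : ℕ → ℕ}
         (D-down : ∀ {k l} → k ≤ l → D l → D k) (E-down : ∀ {k l} → k ≤ l → E l → E k)
         (a-dec : ∀ {k l} → k < l → D l → a l < a k) (b-dec : ∀ {k l} → k < l → E l → b l < b k)
         (a⊆b : ∀ {k} → D k → ∃ λ l → E l × b l ≡ a k)
         (b⊆a : ∀ {l} → E l → ∃ λ k → D k × a k ≡ b l)
         where

  decreasing-enumerations-agree : ∀ k → D k → E k × a k ≡ b k
  decreasing-enumerations-agree = <-rec (λ k → D k → E k × a k ≡ b k) step
    where
    step : ∀ k → (∀ {k′} → k′ < k → D k′ → E k′ × a k′ ≡ b k′) → D k → E k × a k ≡ b k
    step k IH dk with a⊆b dk
    ... | l , el , bl≡ak with <-cmp l k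
    ...   | tri< l<k _ _ = contradiction (trans (proj₂ (IH l<k (D-down (<⇒≤ l<k) dk))) bl≡ak)
                                         (<⇒≢ (a-dec l<k dk) ∘ sym)
    ...   | tri≈ _ refl _ = el , sym bl≡ak
    ...   | tri> _ _ k<l with b⊆a (E-down (<⇒≤ k<l) el)
    ...     | p , dp , ap≡bk with <-cmp p k
    ...       | tri< p<k _ _ = contradiction (trans (sym (proj₂ (IH p<k dp))) ap≡bk)
                                         (<⇒≢ (b-dec p<k (E-down (<⇒≤ k<l) el)) ∘ sym)
    ...       | tri≈ _ refl _ = E-down (<⇒≤ k<l) el , ap≡bk
    ...       | tri> _ _ k<p = ⊥-elim (<-asym (<-≤-trans (a-dec k<p dp) (≤-reflexive (sym bl≡ak)))
                                              (<-≤-trans (b-dec k<l el) (≤-reflexive (sym ap≡bk))))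

part-injective : ∀ {xs ys} → All (1 ≤_) xs → All (1 ≤_) ys →
                 (∀ k → part xs (suc k) ≡ part ys (suc k)) → xs ≡ ys
part-injective []       []       _  = refl
part-injective []       (p ∷ _)  eq = contradiction (eq 0) (<⇒≢ p)
part-injective (p ∷ _)  []       eq = contradiction (sym (eq 0)) (<⇒≢ p)
part-injective (_ ∷ px) (_ ∷ py) eq = cong₂ _∷_ (eq 0) (part-injective px py (eq ∘ suc))

conj-mono-off-diagonal : ∀ {xs ys} → IsPartition xs → IsPartition ys →
                         (∀ {r} → OnDiagonal xs r → part xs (suc r) ≤ part ys (suc r)) →
                         ∀ {k} → ¬ OnDiagonal xs k → conj xs (suc k) ≤ conj ys (suc k)
conj-mono-off-diagonal {xs} {ys} Px Py diag≤ {k} off = ≮⇒≥ λ ys<xs → <-irrefl refl (xs⊆ys ys<xs)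
  where
  xs⊆ys : ∀ {r} → r < conj xs (suc k) → r < conj ys (suc k)
  xs⊆ys {r} r<c =
    ≤part⇒≤conj Py (s≤s z≤n) (≤-trans k<row (diag≤ (reaches-off-diagonal⇒onDiagonal Px off k<row)))
    where
    k<row : suc k ≤ part xs (suc r)
    k<row = ≤conj⇒≤part Px r<c

selfConj-determined-by-diagonal :
  ∀ {xs ys} → IsPartition xs → IsPartition ys → SelfConj xs → SelfConj ys →
  (∀ {k} → OnDiagonal xs k → OnDiagonal ys k × part xs (suc k) ≡ part ys (suc k)) →
  (∀ {k} → OnDiagonal ys k → OnDiagonal xs k × part ys (suc k) ≡ part xs (suc k)) →
  xs ≡ ys
selfConj-determined-by-diagonal {xs} {ys} Px Py SCx SCy xs⊆ys ys⊆xs = part-injective (proj₂ Px) (proj₂ Py) same-row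
  where
  same-row : ∀ k → part xs (suc k) ≡ part ys (suc k)
  same-row k with suc k ≤? part xs (suc k)
  ... | yes diag = proj₂ (xs⊆ys diag)
  ... | no  off  = begin
    part xs (suc k) ≡⟨ SCx (suc k) (s≤s z≤n) ⟨
    conj xs (suc k) ≡⟨ ≤-antisym (conj-mono-off-diagonal Px Py (≤-reflexive ∘ proj₂ ∘ xs⊆ys) off)
                                 (conj-mono-off-diagonal Py Px (≤-reflexive ∘ proj₂ ∘ ys⊆xs) (off ∘ proj₁ ∘ ys⊆xs)) ⟩
    conj ys (suc k) ≡⟨ SCy (suc k) (s≤s z≤n) ⟩
    part ys (suc k) ∎
    where open ≡-Reasoning

-- Building a self-conjugate partition from its diagonal values

raise : ℕ → List ℕ → List ℕ
raise zero    _        = []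
raise (suc n) []       = 1 ∷ raise n []
raise (suc n) (x ∷ xs) = suc x ∷ raise n xs

addHook : ℕ → List ℕ → List ℕ
addHook n xs = suc n ∷ raise n xs

part-raise-< : ∀ {n k} xs → k < n → part (raise n xs) (suc k) ≡ suc (part xs (suc k))
part-raise-< {suc n} {zero}  []       _         = refl
part-raise-< {suc n} {zero}  (x ∷ xs) _         = refl
part-raise-< {suc n} {suc k} []       (s≤s k<n) = part-raise-< [] k<n
part-raise-< {suc n} {suc k} (x ∷ xs) (s≤s k<n) = part-raise-< xs k<n

part-raise-≥ : ∀ {n k} xs → n ≤ k → part (raise n xs) (suc k) ≡ 0
part-raise-≥ {zero}          xs       _         = refl
part-raise-≥ {suc n} {suc k} []       (s≤s n≤k) = part-raise-≥ [] n≤k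
part-raise-≥ {suc n} {suc k} (x ∷ xs) (s≤s n≤k) = part-raise-≥ xs n≤k

conj-raise-1 : ∀ n xs → conj (raise n xs) 1 ≡ n
conj-raise-1 zero    xs       = refl
conj-raise-1 (suc n) []       = cong suc (conj-raise-1 n [])
conj-raise-1 (suc n) (x ∷ xs) = cong suc (conj-raise-1 n xs)

conj-raise : ∀ {n} xs j → length xs ≤ n → conj (raise n xs) (suc (suc j)) ≡ conj xs (suc j)
conj-raise {zero}  []       j _ = refl
conj-raise {suc n} []       j _ =
  trans (conj-∷-≰ {suc (suc j)} {1} (raise n []) λ { (s≤s ()) }) (conj-raise {n} [] j z≤n)
conj-raise {suc n} (x ∷ xs) j (s≤s len) with suc j ≤? x
... | yes j<x = trans (conj-∷-≤ (raise n xs) (s≤s j<x))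
                      (trans (cong suc (conj-raise xs j len)) (sym (conj-∷-≤ xs j<x)))
... | no  j≮x = trans (conj-∷-≰ (raise n xs) (j≮x ∘ s≤s⁻¹))
                      (trans (conj-raise xs j len) (sym (conj-∷-≰ xs j≮x)))

sum-raise : ∀ {n} xs → length xs ≤ n → sum (raise n xs) ≡ n + sum xs
sum-raise {zero}  []       _         = refl
sum-raise {suc n} []       _         = cong suc (sum-raise [] z≤n)
sum-raise {suc n} (x ∷ xs) (s≤s len) = begin
  suc x + sum (raise n xs) ≡⟨ cong (suc x +_) (sum-raise xs len) ⟩
  suc x + (n + sum xs)     ≡⟨ shuffle x n (sum xs) ⟩
  suc n + (x + sum xs)     ∎
  where
  open ≡-Reasoning
  shuffle : ∀ x n m → suc x + (n + m) ≡ suc n + (x + m)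
  shuffle = solve-∀

length-raise : ∀ n xs → length (raise n xs) ≡ n
length-raise zero    xs       = refl
length-raise (suc n) []       = cong suc (length-raise n [])
length-raise (suc n) (x ∷ xs) = cong suc (length-raise n xs)

raise-bounded : ∀ {m} n {xs} → All (_≤ m) xs → All (_≤ suc m) (raise n xs)
raise-bounded zero    _          = []
raise-bounded (suc n) []         = s≤s z≤n ∷ raise-bounded n []
raise-bounded (suc n) (x≤m ∷ ps) = s≤s x≤m ∷ raise-bounded n ps

raise-positive : ∀ n xs → All (1 ≤_) (raise n xs)
raise-positive zero    _        = []
raise-positive (suc n) []       = s≤s z≤n ∷ raise-positive n []
raise-positive (suc n) (x ∷ xs) = s≤s z≤n ∷ raise-positive n xs

Linked-≥-∷ : ∀ {x ys} → All (_≤ x) ys → Linked _≥_ ys → Linked _≥_ (x ∷ ys)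
Linked-≥-∷ []          _   = [-]
Linked-≥-∷ (y≤x ∷ _)   dec = y≤x ∷ dec

raise-decreasing : ∀ n {xs} → Linked _≥_ xs → Linked _≥_ (raise n xs)
raise-decreasing zero    _   = []
raise-decreasing (suc n) {[]}     _   = Linked-≥-∷ (raise-bounded n []) (raise-decreasing n [])
raise-decreasing (suc n) {x ∷ xs} dec =
  Linked-≥-∷ (raise-bounded n (head-bounds dec)) (raise-decreasing n (Linked.tail dec))

FitsIn : ℕ → List ℕ → Set
FitsIn n xs = All (_≤ n) xs × length xs ≤ n

module _ {n : ℕ} {xs : List ℕ} (fits : FitsIn n xs) where

  addHook-partition : Linked _≥_ xs → IsPartition (addHook n xs)
  addHook-partition dec =
    Linked-≥-∷ (raise-bounded n (proj₁ fits)) (raise-decreasing n dec) , s≤s z≤n ∷ raise-positive n xs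

  addHook-conj-1 : conj (addHook n xs) 1 ≡ suc n
  addHook-conj-1 = trans (conj-∷-≤ (raise n xs) (s≤s (z≤n {n}))) (cong suc (conj-raise-1 n xs))

  addHook-conj-< : ∀ {k} → k < n → conj (addHook n xs) (suc (suc k)) ≡ suc (conj xs (suc k))
  addHook-conj-< {k} k<n = trans (conj-∷-≤ (raise n xs) (s≤s k<n)) (cong suc (conj-raise xs k (proj₂ fits)))

  addHook-conj-≥ : ∀ {k} → n ≤ k → conj (addHook n xs) (suc (suc k)) ≡ 0
  addHook-conj-≥ {k} n≤k = begin
    conj (addHook n xs) (suc (suc k)) ≡⟨ conj-∷-≰ (raise n xs) (<⇒≱ (s≤s (s≤s n≤k))) ⟩
    conj (raise n xs) (suc (suc k))   ≡⟨ conj-raise xs k (proj₂ fits) ⟩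
    conj xs (suc k)                   ≡⟨ conj-all-< xs (All.map (λ x≤n → s≤s (≤-trans x≤n n≤k)) (proj₁ fits)) ⟩
    0                                 ∎
    where open ≡-Reasoning

  addHook-selfConj : SelfConj xs → SelfConj (addHook n xs)
  addHook-selfConj SC (suc zero)    _ = addHook-conj-1
  addHook-selfConj SC (suc (suc k)) _ with k <? n
  ... | yes k<n = trans (addHook-conj-< k<n) (trans (cong suc (SC (suc k) (s≤s z≤n))) (sym (part-raise-< xs k<n)))
  ... | no  k≮n = trans (addHook-conj-≥ (≮⇒≥ k≮n)) (sym (part-raise-≥ xs (≮⇒≥ k≮n)))

  addHook-hook-first-row : SelfConj xs → ∀ {k} → k < n →
                           hook (addHook n xs) 1 (suc (suc k)) ≡ (n ∸ suc k) + part xs (suc k) + 1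
  addHook-hook-first-row SC {k} k<n =
    cong (λ c → (n ∸ suc k) + (c ∸ 1) + 1) (trans (addHook-conj-< k<n) (cong suc (SC (suc k) (s≤s z≤n))))

  addHook-hook-inner : ∀ {k l} → k < n → l < n →
                       hook (addHook n xs) (suc (suc k)) (suc (suc l)) ≡ hook xs (suc k) (suc l)
  addHook-hook-inner {k} {l} k<n l<n =
    cong₂ (λ r c → (r ∸ suc (suc l)) + (c ∸ suc (suc k)) + 1) (part-raise-< xs k<n) (addHook-conj-< l<n)

  addHook-onDiagonal⁻ : ∀ {k} → OnDiagonal (addHook n xs) (suc k) → k < n × OnDiagonal xs k
  addHook-onDiagonal⁻ {k} diag with k <? n
  ... | yes k<n = k<n , s≤s⁻¹ (subst (suc (suc k) ≤_) (part-raise-< xs k<n) diag)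
  ... | no  k≮n = contradiction (subst (suc (suc k) ≤_) (part-raise-≥ xs (≮⇒≥ k≮n)) diag) λ ()

  onDiagonal⇒< : ∀ {k} → OnDiagonal xs k → k < n
  onDiagonal⇒< {k} diag = ≤-trans diag (part-all-≤ xs (suc k) (proj₁ fits))

  addHook-onDiagonal⁺ : ∀ {k} → OnDiagonal xs k → OnDiagonal (addHook n xs) (suc k)
  addHook-onDiagonal⁺ {k} diag = subst (suc (suc k) ≤_) (sym (part-raise-< xs (onDiagonal⇒< diag))) (s≤s diag)

  addHook-diagValue : ∀ {k} → k < n → diagValue (addHook n xs) (suc k) ≡ diagValue xs k
  addHook-diagValue {k} k<n = cong (_∸ suc k) (part-raise-< xs k<n)

-- 2u − 1, the hook length of a diagonal box of value u.
diagHook : ℕ → ℕ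
diagHook u = u + pred u

diagHookIf : Bool → ℕ → ℕ
diagHookIf b u = if b then diagHook u else 0

weight : (ℕ → Bool) → ℕ → ℕ
weight S zero    = 0
weight S (suc n) = diagHookIf (S (suc n)) (suc n) + weight S n

-- The self-conjugate partition whose diagonal values are the elements of S in [1, n].
fromSet : (ℕ → Bool) → ℕ → List ℕ
fromSet S zero    = []
fromSet S (suc n) = if S (suc n) then addHook n (fromSet S n) else fromSet S n

fromSet-fits : ∀ S n → FitsIn n (fromSet S n)
fromSet-fits S zero = [] , z≤n
fromSet-fits S (suc n) with S (suc n) | fromSet-fits S n
... | true  | bounded , short = (≤-refl ∷ raise-bounded n bounded) , s≤s (≤-reflexive (length-raise n _))
... | false | bounded , short = All.map m≤n⇒m≤1+n bounded , m≤n⇒m≤1+n short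

fromSet-partition : ∀ S n → IsPartition (fromSet S n)
fromSet-partition S zero = [] , []
fromSet-partition S (suc n) with S (suc n)
... | true  = addHook-partition (fromSet-fits S n) (proj₁ (fromSet-partition S n))
... | false = fromSet-partition S n

fromSet-selfConj : ∀ S n → SelfConj (fromSet S n)
fromSet-selfConj S zero j _ = refl
fromSet-selfConj S (suc n) with S (suc n)
... | true  = addHook-selfConj (fromSet-fits S n) (fromSet-selfConj S n)
... | false = fromSet-selfConj S n

fromSet-size : ∀ S n → size (fromSet S n) ≡ weight S n
fromSet-size S zero = refl
fromSet-size S (suc n) with S (suc n)
... | false = fromSet-size S n
... | true  = begin
  suc n + sum (raise n (fromSet S n)) ≡⟨ cong (suc n +_) (sum-raise (fromSet S n) (proj₂ (fromSet-fits S n))) ⟩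
  suc n + (n + size (fromSet S n))    ≡⟨ +-assoc (suc n) n _ ⟨
  diagHook (suc n) + size (fromSet S n) ≡⟨ cong (diagHook (suc n) +_) (fromSet-size S n) ⟩
  diagHook (suc n) + weight S n       ∎
  where open ≡-Reasoning

fromSet-diagValue : ∀ S n {k} → OnDiagonal (fromSet S n) k → S (diagValue (fromSet S n) k) ≡ true
fromSet-diagValue S zero ()
fromSet-diagValue S (suc n) {k} diag with S (suc n) in Sn
... | false = fromSet-diagValue S n diag
fromSet-diagValue S (suc n) {zero} diag | true = Sn
fromSet-diagValue S (suc n) {suc k} diag | true with addHook-onDiagonal⁻ (fromSet-fits S n) diag
... | k<n , diag′ =
  subst (λ u → S u ≡ true) (sym (addHook-diagValue (fromSet-fits S n) k<n)) (fromSet-diagValue S n diag′)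

fromSet-realises : ∀ S n {w} → S w ≡ true → 1 ≤ w → w ≤ n →
                   ∃ λ k → OnDiagonal (fromSet S n) k × diagValue (fromSet S n) k ≡ w
fromSet-realises S zero    Sw 1≤w w≤0 = contradiction w≤0 (<⇒≱ 1≤w)
fromSet-realises S (suc n) {w} Sw 1≤w w≤1+n with S (suc n) in Sn | w ≟ suc n
... | false | yes refl = ⊥-elim (not-¬ Sw Sn)
... | false | no  w≢  = fromSet-realises S n Sw 1≤w (s≤s⁻¹ (≤∧≢⇒< w≤1+n w≢))
... | true  | yes refl = zero , s≤s z≤n , refl
... | true  | no  w≢  with fromSet-realises S n Sw 1≤w (s≤s⁻¹ (≤∧≢⇒< w≤1+n w≢))
...   | k , diag , value = suc k , addHook-onDiagonal⁺ fits diag ,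
                           trans (addHook-diagValue fits (onDiagonal⇒< fits diag)) value
  where
  fits : FitsIn n (fromSet S n)
  fits = fromSet-fits S n

Sparse : (ℕ → Bool) → Set
Sparse S = ∀ {u} → S u ≡ true → S (suc u) ≡ false

fromSet-consecutive-strict : ∀ {S} → Sparse S → ∀ n {k} → OnDiagonal (fromSet S n) (suc k) →
                             part (fromSet S n) (suc (suc k)) < part (fromSet S n) (suc k)
fromSet-consecutive-strict {S} sparse (suc n) {k} diag with S (suc n) in Sn
... | false = fromSet-consecutive-strict sparse n diag
fromSet-consecutive-strict {S} sparse (suc n) {zero} diag | true
  with addHook-onDiagonal⁻ (fromSet-fits S n) diag
... | 0<n , _ = subst (_< suc n) (sym (part-raise-< (fromSet S n) 0<n)) (s≤s (row<n n 0<n Sn))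
  where
  row<n : ∀ m → 0 < m → S (suc m) ≡ true → part (fromSet S m) 1 < m
  row<n (suc m) _ S[2+m] with S (suc m) in S[1+m]
  ... | true  = ⊥-elim (not-¬ S[2+m] (sparse S[1+m]))
  ... | false = s≤s (part-all-≤ (fromSet S m) 1 (proj₁ (fromSet-fits S m)))
fromSet-consecutive-strict {S} sparse (suc n) {suc k} diag | true
  with addHook-onDiagonal⁻ (fromSet-fits S n) diag
... | 1+k<n , diag′ =
  subst₂ _<_ (sym (part-raise-< (fromSet S n) 1+k<n)) (sym (part-raise-< (fromSet S n) (<⇒≤ 1+k<n)))
        (s≤s (fromSet-consecutive-strict sparse n diag′))

StrictDiagonal : List ℕ → Set
StrictDiagonal xs = ∀ {k l} → k < l → OnDiagonal xs l → part xs (suc l) < part xs (suc k)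

module _ {xs : List ℕ} (P : IsPartition xs) where

  distinctTop⇒strictDiagonal : DistinctTop xs → StrictDiagonal xs
  distinctTop⇒strictDiagonal DT {k} {l} k<l diag =
    ≤∧≢⇒< (part-anti P (<⇒≤ k<l)) (DT (suc k) (suc l) (s≤s z≤n) (s≤s k<l) (onDiagonal⇒≤s P diag) ∘ sym)

  strictDiagonal⇒distinctTop : StrictDiagonal xs → DistinctTop xs
  strictDiagonal⇒distinctTop decreasing (suc k) (suc l) _ k<l l≤s eq =
    <⇒≢ (decreasing (s≤s⁻¹ k<l) (≤s⇒onDiagonal P l≤s)) (sym eq)

  consecutive⇒strictDiagonal : (∀ {k} → OnDiagonal xs (suc k) → part xs (suc (suc k)) < part xs (suc k)) →
                               StrictDiagonal xs
  consecutive⇒strictDiagonal consecutive {k} {suc l} (s≤s k≤l) diag =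
    <-≤-trans (consecutive diag) (part-anti P k≤l)

  diagValue-gap : StrictDiagonal xs → ∀ {k l} → k < l → OnDiagonal xs l → diagValue xs l + 2 ≤ diagValue xs k
  diagValue-gap decreasing {k} {l} k<l diag = +-cancelʳ-≤ k _ _ (begin
    diagValue xs l + 2 + k     ≡⟨ shift (diagValue xs l) k ⟩
    suc (diagValue xs l + suc k) ≤⟨ s≤s (+-monoʳ-≤ (diagValue xs l) k<l) ⟩
    suc (diagValue xs l + l)   ≡⟨ cong suc (part≡diagValue+k {xs} diag) ⟨
    suc (part xs (suc l))      ≤⟨ decreasing k<l diag ⟩
    part xs (suc k)            ≡⟨ part≡diagValue+k {xs} (onDiagonal-down P (<⇒≤ k<l) diag) ⟩
    diagValue xs k + k         ∎)
    where
    open ≤-Reasoning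
    shift : ∀ v k → v + 2 + k ≡ suc (v + suc k)
    shift = solve-∀

  diagValue-< : StrictDiagonal xs → ∀ {k l} → k < l → OnDiagonal xs l → diagValue xs l < diagValue xs k
  diagValue-< decreasing k<l diag =
    ≤-trans (≤-reflexive (+-comm 1 _)) (≤-trans (+-monoʳ-≤ _ (s≤s z≤n)) (diagValue-gap decreasing k<l diag))

  diagValue-apart : StrictDiagonal xs → ∀ {k l} → OnDiagonal xs k → OnDiagonal xs l →
                    diagValue xs l ≢ suc (diagValue xs k)
  diagValue-apart decreasing {k} {l} dk dl eq with <-cmp k l
  ... | tri< k<l _ _  = <-irrefl refl (≤-trans (m≤m+n _ 2)
                          (subst (λ v → v + 2 ≤ diagValue xs k) eq (diagValue-gap decreasing k<l dl)))
  ... | tri≈ _ refl _ = <-irrefl eq (n<1+n _)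
  ... | tri> _ _ l<k  = <-irrefl refl (≤-trans (≤-reflexive (+-comm 2 _))
                          (≤-trans (diagValue-gap decreasing l<k dk) (≤-reflexive eq)))

fromSet-strictDiagonal : ∀ {S} → Sparse S → ∀ n → StrictDiagonal (fromSet S n)
fromSet-strictDiagonal {S} sparse n =
  consecutive⇒strictDiagonal (fromSet-partition S n) (fromSet-consecutive-strict sparse n)

-- u + v − 1 is the hook length of the box in the rows of the diagonal boxes of values u and v;
-- every other hook of fromSet S n is shorter than its outermost diagonal value.
SumOrBelow : (ℕ → Bool) → ℕ → Set
SumOrBelow S h = (∃ λ u → ∃ λ v → S u ≡ true × S v ≡ true × suc h ≡ u + v)
               ⊎ (∃ λ u → S u ≡ true × h < u)

module _ {S : ℕ → Bool} {n : ℕ} {xs : List ℕ} (Sn : S (suc n) ≡ true) (fits : FitsIn n xs)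
         (P : IsPartition xs) (SC : SelfConj xs) (diag∈S : ∀ {k} → OnDiagonal xs k → S (diagValue xs k) ≡ true)
         (hooks : ∀ {i j} → Box xs i j → SumOrBelow S (hook xs i j)) where

  private
    P′ : IsPartition (addHook n xs)
    P′ = addHook-partition fits (proj₁ P)

    SC′ : SelfConj (addHook n xs)
    SC′ = addHook-selfConj fits SC

    first-row : ∀ {j} → 1 ≤ j → j ≤ suc n → SumOrBelow S (hook (addHook n xs) 1 j)
    first-row {suc zero} _ _ = inj₁ (suc n , suc n , Sn , Sn , corner)
      where
      double : ∀ n → suc (n + n + 1) ≡ suc n + suc n
      double = solve-∀
      corner : suc (hook (addHook n xs) 1 1) ≡ suc n + suc n
      corner = trans (cong (λ c → suc (n + (c ∸ 1) + 1)) (addHook-conj-1 fits)) (double n)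
    first-row {suc (suc k)} _ (s≤s k<n) with suc k ≤? part xs (suc k)
    ... | yes diag = inj₁ (suc n , diagValue xs k , Sn , diag∈S diag , (begin
      suc (hook (addHook n xs) 1 (suc (suc k)))   ≡⟨ cong suc (addHook-hook-first-row fits SC k<n) ⟩
      suc ((n ∸ suc k) + part xs (suc k) + 1)     ≡⟨ cong (λ p → suc ((n ∸ suc k) + p + 1))
                                                             (part≡diagValue+k {xs} diag) ⟩
      suc ((n ∸ suc k) + (diagValue xs k + k) + 1) ≡⟨ regroup (n ∸ suc k) (diagValue xs k) k ⟩
      suc ((n ∸ suc k) + suc k) + diagValue xs k  ≡⟨ cong (λ m → suc m + diagValue xs k) (m∸n+n≡m k<n) ⟩
      suc n + diagValue xs k                      ∎))
      where
      open ≡-Reasoning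
      regroup : ∀ d v k → suc (d + (v + k) + 1) ≡ suc (d + suc k) + v
      regroup = solve-∀
    ... | no  off  = inj₂ (suc n , Sn , s≤s (begin
      hook (addHook n xs) 1 (suc (suc k)) ≡⟨ addHook-hook-first-row fits SC k<n ⟩
      (n ∸ suc k) + part xs (suc k) + 1   ≡⟨ +-assoc (n ∸ suc k) _ 1 ⟩
      (n ∸ suc k) + (part xs (suc k) + 1) ≡⟨ cong ((n ∸ suc k) +_) (+-comm (part xs (suc k)) 1) ⟩
      (n ∸ suc k) + suc (part xs (suc k)) ≤⟨ +-monoʳ-≤ (n ∸ suc k) (s≤s (≮⇒≥ off)) ⟩
      (n ∸ suc k) + suc k                 ≡⟨ m∸n+n≡m k<n ⟩
      n                                   ∎))
      where open ≤-Reasoning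

  addHook-hooks : ∀ {i j} → Box (addHook n xs) i j → SumOrBelow S (hook (addHook n xs) i j)
  addHook-hooks {suc zero} (_ , 1≤j , j≤1+n) = first-row 1≤j j≤1+n
  addHook-hooks {suc (suc k)} {suc zero} box@(1≤i , 1≤j , _) with box-transpose P′ SC′ box
  ... | _ , _ , i≤1+n = subst (SumOrBelow S) (hook-transpose {addHook n xs} SC′ 1≤i 1≤j) (first-row 1≤i i≤1+n)
  addHook-hooks {suc (suc k)} {suc (suc l)} (_ , _ , l<row) with k <? n
  ... | no  k≮n = contradiction (subst (suc (suc l) ≤_) (part-raise-≥ xs (≮⇒≥ k≮n)) l<row) λ ()
  ... | yes k<n = subst (SumOrBelow S) (sym (addHook-hook-inner fits k<n l<n)) (hooks (s≤s z≤n , s≤s z≤n , l<row′))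
    where
    l<row′ : suc l ≤ part xs (suc k)
    l<row′ = s≤s⁻¹ (subst (suc (suc l) ≤_) (part-raise-< xs k<n) l<row)
    l<n : l < n
    l<n = ≤-trans l<row′ (part-all-≤ xs (suc k) (proj₁ fits))

fromSet-hooks : ∀ S n {i j} → Box (fromSet S n) i j → SumOrBelow S (hook (fromSet S n) i j)
fromSet-hooks S zero {suc i} {suc j} (_ , _ , ())
fromSet-hooks S (suc n) box with S (suc n) in Sn
... | false = fromSet-hooks S n box
... | true  = addHook-hooks Sn (fromSet-fits S n) (fromSet-partition S n) (fromSet-selfConj S n)
                            (fromSet-diagValue S n) (fromSet-hooks S n) box

-- The sets of diagonal values of the members of DS(t), as shown by fromSet-DS and diagSet-admissible.
record Admissible (t : ℕ) (S : ℕ → Bool) : Set where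
  field
    positive : ∀ {u} → S u ≡ true → 1 ≤ u
    bounded : ∀ {u} → S u ≡ true → u ≤ t
    sparse  : Sparse S
    sum≢1+t : ∀ {u v} → S u ≡ true → S v ≡ true → u + v ≢ suc t
    sum≢2+t : ∀ {u v} → S u ≡ true → S v ≡ true → u + v ≢ suc (suc t)

∣∧<double⇒≡ : ∀ {d h} → d ∣ h → 0 < h → h < d + d → h ≡ d
∣∧<double⇒≡ (divides-refl zero) () _
∣∧<double⇒≡ {d} (divides-refl 1) _ _ = +-identityʳ d
∣∧<double⇒≡ {d} (divides-refl (suc (suc q))) _ h<2d =
  contradiction h<2d (≤⇒≯ (+-monoʳ-≤ d (m≤m+n d (q * d))))

module _ {t : ℕ} {S : ℕ → Bool} (A : Admissible t S) where
  open Admissible A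

  sumOrBelow-core : ∀ {h} → 0 < h → SumOrBelow S h → ¬ t ∣ h × ¬ suc t ∣ h
  sumOrBelow-core {h} 0<h (inj₂ (u , Su , h<u)) =
    (λ t∣h → <⇒≱ (<-≤-trans h<u (bounded Su)) (∣⇒≤ ⦃ >-nonZero 0<h ⦄ t∣h)) ,
    (λ 1+t∣h → <⇒≱ (<-≤-trans h<u (m≤n⇒m≤1+n (bounded Su))) (∣⇒≤ ⦃ >-nonZero 0<h ⦄ 1+t∣h))
  sumOrBelow-core {h} 0<h (inj₁ (u , v , Su , Sv , 1+h≡u+v)) =
    (λ t∣h → sum≢1+t Su Sv (trans (sym 1+h≡u+v) (cong suc (∣∧<double⇒≡ t∣h 0<h h<2t)))) ,
    (λ 1+t∣h → sum≢2+t Su Sv (trans (sym 1+h≡u+v) (cong suc (∣∧<double⇒≡ 1+t∣h 0<h h<2+2t))))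
    where
    h<2t : h < t + t
    h<2t = ≤-trans (≤-reflexive 1+h≡u+v) (+-mono-≤ (bounded Su) (bounded Sv))
    h<2+2t : h < suc t + suc t
    h<2+2t = ≤-trans h<2t (+-mono-≤ (n≤1+n t) (n≤1+n t))

  fromSet-DS : DS t (fromSet S t)
  fromSet-DS = P , (λ i j box → proj₁ (hook-core box)) , (λ i j box → proj₂ (hook-core box)) ,
               fromSet-selfConj S t , strictDiagonal⇒distinctTop P (fromSet-strictDiagonal sparse t)
    where
    P : IsPartition (fromSet S t)
    P = fromSet-partition S t
    hook-core : ∀ {i j} → Box (fromSet S t) i j →
                ¬ t ∣ hook (fromSet S t) i j × ¬ suc t ∣ hook (fromSet S t) i j
    hook-core box = sumOrBelow-core (m≤n+m 1 _) (fromSet-hooks S t box)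

-- The first row of a member of DS(t)

sum-bound : ∀ {t h a u b} → h + a ≡ u + b → a ≤ suc b → t < u → t ≤ h
sum-bound {t} {h} {a} {u} {b} eq a≤1+b t<u = +-cancelʳ-≤ a t h (begin
  t + a       ≤⟨ +-monoʳ-≤ t a≤1+b ⟩
  t + suc b   ≡⟨ +-suc t b ⟩
  suc t + b   ≤⟨ +-monoˡ-≤ b t<u ⟩
  u + b       ≡⟨ eq ⟨
  h + a       ∎)
  where open ≤-Reasoning

two-step-bound : ∀ {t h h′ k p q u} → h + suc k ≡ u + p → h′ + suc (suc k) ≡ u + q → p ≤ suc q →
                 t + 2 ≤ h → t ≤ h′
two-step-bound {t} {h} {h′} {k} {p} {q} {u} eq eq′ p≤1+q t+2≤h = +-cancelʳ-≤ (suc (suc (suc k))) t h′ (begin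
  t + suc (suc (suc k))  ≡⟨ shuffle t k ⟩
  (t + 2) + suc k        ≤⟨ +-monoˡ-≤ (suc k) t+2≤h ⟩
  h + suc k              ≡⟨ eq ⟩
  u + p                  ≤⟨ +-monoʳ-≤ u p≤1+q ⟩
  u + suc q              ≡⟨ +-suc u q ⟩
  suc (u + q)            ≡⟨ cong suc eq′ ⟨
  suc (h′ + suc (suc k)) ≡⟨ +-suc h′ (suc (suc k)) ⟨
  h′ + suc (suc (suc k)) ∎)
  where
  open ≤-Reasoning
  shuffle : ∀ t k → t + suc (suc (suc k)) ≡ (t + 2) + suc k
  shuffle = solve-∀

crossing : ∀ (h : ℕ → ℕ) c A d → c ≤ h A → h (A + d) < c →
           (∀ j → A ≤ j → j < A + d → c + 2 ≤ h j → c ≤ h (suc j)) →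
           ∃ λ j → A ≤ j × j ≤ A + d × (h j ≡ c ⊎ h j ≡ suc c)
crossing h c A zero    c≤hA end _ = contradiction (subst (λ j → h j < c) (+-identityʳ A) end) (≤⇒≯ c≤hA)
crossing h c A (suc d) c≤hA end no-jump with h A ≤? suc c
... | yes hA≤1+c = A , ≤-refl , m≤m+n A (suc d) ,
                   [ (λ hA<1+c → inj₁ (≤-antisym (s≤s⁻¹ hA<1+c) c≤hA)) , inj₂ ]′ (m≤n⇒m<n∨m≡n hA≤1+c)
... | no  hA≰1+c with crossing h c (suc A) d
                        (no-jump A ≤-refl (m<m+n A z<s) (≤-trans (≤-reflexive (+-comm c 2)) (≰⇒> hA≰1+c)))
                        (subst (λ j → h j < c) (+-suc A d) end)
                        (λ j A<j j<end → no-jump j (<⇒≤ A<j) (subst (j <_) (sym (+-suc A d)) j<end))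
...   | j , A<j , j≤end , hit = j , <⇒≤ A<j , subst (j ≤_) (sym (+-suc A d)) j≤end , hit

module _ {xs : List ℕ} (P : IsPartition xs) (SC : SelfConj xs) (decreasing : StrictDiagonal xs) where

  row-length-between : ∀ {k i} → conj xs (suc (suc k)) ≤ i → suc i ≤ conj xs (suc k) → part xs (suc i) ≡ suc k
  row-length-between {k} {i} conj≤i i<conj = ≤-antisym (≮⇒≥ too-long) (≤conj⇒≤part P i<conj)
    where
    too-long : ¬ (suc k < part xs (suc i))
    too-long long = <⇒≱ (≤part⇒≤conj P (s≤s z≤n) long) conj≤i

  -- Two columns differing by two force two rows of equal length inside the Durfee square.
  off-diagonal-descent : ∀ {k} → ¬ OnDiagonal xs k → part xs (suc k) ≤ suc (part xs (suc (suc k)))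
  off-diagonal-descent {k} off with part xs (suc k) ≤? suc (part xs (suc (suc k)))
  ... | yes small = small
  ... | no  big   = contradiction (decreasing (n<1+n d) diag) (<-irrefl (trans row-d+1 (sym row-d)))
    where
    d : ℕ
    d = part xs (suc (suc k))
    conj-d : conj xs (suc (suc k)) ≡ d
    conj-d = SC (suc (suc k)) (s≤s z≤n)
    d+2≤conj : suc (suc d) ≤ conj xs (suc k)
    d+2≤conj = subst (suc (suc d) ≤_) (sym (SC (suc k) (s≤s z≤n))) (≰⇒> big)
    row-d : part xs (suc d) ≡ suc k
    row-d = row-length-between (≤-reflexive conj-d) (<⇒≤ d+2≤conj)
    row-d+1 : part xs (suc (suc d)) ≡ suc k
    row-d+1 = row-length-between (≤-trans (≤-reflexive conj-d) (n≤1+n d)) d+2≤conj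
    diag : OnDiagonal xs (suc d)
    diag = subst (suc (suc d) ≤_) (sym row-d+1) (≤-trans (≰⇒> big) (≤-trans (≮⇒≥ off) (n≤1+n k)))

  onDiagonal⇒next-row-≥ : ∀ {k} → OnDiagonal xs k → k ≤ part xs (suc (suc k))
  onDiagonal⇒next-row-≥ {zero}  _    = z≤n
  onDiagonal⇒next-row-≥ {suc k} diag =
    proj₂ (proj₂ (box-transpose P SC (s≤s z≤n , s≤s z≤n , ≤-trans (s≤s diag) (decreasing (n<1+n k) diag))))

  descent-or-long-next-row : ∀ k → part xs (suc k) ≤ suc (part xs (suc (suc k))) ⊎ suc k ≤ part xs (suc (suc k))
  descent-or-long-next-row k with suc k ≤? part xs (suc k)
  ... | no  off  = inj₁ (off-diagonal-descent off)
  ... | yes diag with part xs (suc k) ≤? suc (part xs (suc (suc k)))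
  ...   | yes small = inj₁ small
  ...   | no  big   = inj₂ (proj₂ (proj₂ (box-transpose P SC (s≤s z≤n , s≤s z≤n ,
                        ≤-trans (s≤s (s≤s (onDiagonal⇒next-row-≥ diag))) (≰⇒> big)))))

  first-row-hook : ∀ {j} → 1 ≤ j → j ≤ part xs 1 → hook xs 1 j + j ≡ part xs 1 + part xs j
  first-row-hook {suc k} 1≤j j≤u = begin
    hook xs 1 (suc k) + suc k
      ≡⟨ cong (_+ suc k) (hook-selfConj {xs} SC 1 (suc k) 1≤j) ⟩
    (part xs 1 ∸ suc k) + (part xs (suc k) ∸ 1) + 1 + suc k
      ≡⟨ regroup (part xs 1 ∸ suc k) (part xs (suc k) ∸ 1) (suc k) ⟩
    ((part xs 1 ∸ suc k) + suc k) + ((part xs (suc k) ∸ 1) + 1)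
      ≡⟨ cong₂ _+_ (m∸n+n≡m j≤u) (m∸n+n≡m row≥1) ⟩
    part xs 1 + part xs (suc k) ∎
    where
    open ≡-Reasoning
    regroup : ∀ a b j → a + b + 1 + j ≡ (a + j) + (b + 1)
    regroup = solve-∀
    row≥1 : 1 ≤ part xs (suc k)
    row≥1 = ≤conj⇒≤part P (subst (suc k ≤_) (sym (SC 1 (s≤s z≤n))) j≤u)

  second-row-shorter : 2 ≤ part xs 1 → part xs 2 < part xs 1
  second-row-shorter 2≤u with 2 ≤? part xs 2
  ... | yes diag = decreasing z<s diag
  ... | no  off  = <-≤-trans (s≤s (≮⇒≥ off)) 2≤u

  last-first-row-box : ∀ {v} → part xs 1 ≡ suc v → 1 ≤ v → part xs (suc v) ≡ 1
  last-first-row-box {v} u≡ 1≤v =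
    ≤-antisym (≮⇒≥ too-long) (≤conj⇒≤part P (≤-reflexive (sym (trans (SC 1 (s≤s z≤n)) u≡))))
    where
    too-long : ¬ (1 < part xs (suc v))
    too-long long = <⇒≱ (second-row-shorter (≤-trans (s≤s 1≤v) (≤-reflexive (sym u≡))))
                         (≤-trans (≤-reflexive u≡) (subst (suc v ≤_) (SC 2 (s≤s z≤n)) (≤part⇒≤conj P (s≤s z≤n) long)))

  first-row-no-jump : ∀ {t k} → t < part xs 1 → suc (suc k) ≤ part xs 1 →
                      t + 2 ≤ hook xs 1 (suc k) → t ≤ hook xs 1 (suc (suc k))
  first-row-no-jump {t} {k} t<u k<u with descent-or-long-next-row k
  ... | inj₁ small = two-step-bound (first-row-hook (s≤s z≤n) (<⇒≤ k<u)) (first-row-hook (s≤s z≤n) k<u) small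
  ... | inj₂ long  = λ _ → sum-bound (first-row-hook (s≤s z≤n) k<u) (s≤s long) t<u

  first-row-≤ : ∀ {t} → 2 ≤ t → IsCore t xs → IsCore (suc t) xs → part xs 1 ≤ t
  first-row-≤ {t} 2≤t core core′ with part xs 1 in u≡
  ... | zero  = z≤n
  ... | suc v = ≮⇒≥ λ t<u → hit (crossing (hook xs 1) t 1 v (start t<u) (end t<u) (no-jump t<u))
    where
    box : ∀ {j} → 1 ≤ j → j ≤ suc v → Box xs 1 j
    box 1≤j j≤u = s≤s z≤n , 1≤j , ≤-trans j≤u (≤-reflexive (sym u≡))

    hit : (∃ λ j → 1 ≤ j × j ≤ suc v × (hook xs 1 j ≡ t ⊎ hook xs 1 j ≡ suc t)) → ⊥
    hit (j , 1≤j , j≤u , inj₁ h≡t)   = core  1 j (box 1≤j j≤u) (subst (t ∣_)     (sym h≡t)   ∣-refl)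
    hit (j , 1≤j , j≤u , inj₂ h≡1+t) = core′ 1 j (box 1≤j j≤u) (subst (suc t ∣_) (sym h≡1+t) ∣-refl)

    start : t < suc v → t ≤ hook xs 1 1
    start t<u = sum-bound (trans (first-row-hook ≤-refl (≤-trans (s≤s z≤n) (≤-reflexive (sym u≡)))) (cong₂ _+_ u≡ u≡))
                          (s≤s z≤n) t<u

    end : t < suc v → hook xs 1 (suc v) < t
    end t<u = ≤-trans (s≤s (≤-reflexive (+-cancelʳ-≡ (suc v) _ 1 h+u≡1+u))) 2≤t
      where
      1≤v : 1 ≤ v
      1≤v = s≤s⁻¹ (≤-trans (s≤s (≤-trans (s≤s z≤n) 2≤t)) t<u)
      h+u≡1+u : hook xs 1 (suc v) + suc v ≡ 1 + suc v
      h+u≡1+u = trans (first-row-hook (s≤s z≤n) (≤-reflexive (sym u≡)))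
                      (trans (cong₂ _+_ u≡ (last-first-row-box u≡ 1≤v)) (+-comm (suc v) 1))

    no-jump : t < suc v → ∀ j → 1 ≤ j → j < suc v → t + 2 ≤ hook xs 1 j → t ≤ hook xs 1 (suc j)
    no-jump t<u (suc k) _ j<u =
      first-row-no-jump (≤-trans t<u (≤-reflexive (sym u≡))) (≤-trans j<u (≤-reflexive (sym u≡)))

-- The diagonal values of a member of DS(t)

<part⇒<length : ∀ xs {k} → 0 < part xs (suc k) → k < length xs
<part⇒<length (x ∷ xs) {zero}  _   = s≤s z≤n
<part⇒<length (x ∷ xs) {suc k} 0<p = s≤s (<part⇒<length xs 0<p)

diagonalAt? : ∀ xs w k → Dec (OnDiagonal xs k × diagValue xs k ≡ w)
diagonalAt? xs w k = (suc k ≤? part xs (suc k)) ×-dec (diagValue xs k ≟ w)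

diagSet : List ℕ → ℕ → Bool
diagSet xs w = does (any? (diagonalAt? xs w) (upTo (length xs)))

diagSet-sound : ∀ xs {w} → diagSet xs w ≡ true → ∃ λ k → OnDiagonal xs k × diagValue xs k ≡ w
diagSet-sound xs {w} found with any? (diagonalAt? xs w) (upTo (length xs))
... | yes some = satisfied some
diagSet-sound xs () | no _

diagSet-complete : ∀ xs {k} → OnDiagonal xs k → diagSet xs (diagValue xs k) ≡ true
diagSet-complete xs {k} diag =
  dec-true (any? (diagonalAt? xs (diagValue xs k)) (upTo (length xs)))
           (lose (∈-upTo⁺ (<part⇒<length xs (≤-trans (s≤s z≤n) diag))) (diag , refl))

module _ {t : ℕ} {xs : List ℕ} (2≤t : 2 ≤ t) (ds : DS t xs) where

  private
    P : IsPartition xs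
    P = proj₁ ds
    core : IsCore t xs
    core = proj₁ (proj₂ ds)
    core′ : IsCore (suc t) xs
    core′ = proj₁ (proj₂ (proj₂ ds))
    SC : SelfConj xs
    SC = proj₁ (proj₂ (proj₂ (proj₂ ds)))
    decreasing : StrictDiagonal xs
    decreasing = distinctTop⇒strictDiagonal P (proj₂ (proj₂ (proj₂ (proj₂ ds))))

    diagonal-sum : ∀ {c u v} → diagSet xs u ≡ true → diagSet xs v ≡ true → u + v ≡ suc c →
                   ∃ λ i → ∃ λ j → Box xs i j × hook xs i j ≡ c
    diagonal-sum {c} Su Sv u+v≡ with diagSet-sound xs Su | diagSet-sound xs Sv
    ... | k , dk , refl | l , dl , refl =
      suc k , suc l , (s≤s z≤n , s≤s z≤n , diagonal-box P dk dl) , suc-injective (trans (hook-diagonal P SC dk dl) u+v≡)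

  diagSet-admissible : Admissible t (diagSet xs)
  diagSet-admissible = record
    { positive = positive
    ; bounded = bounded
    ; sparse  = sparse
    ; sum≢1+t = λ Su Sv u+v≡ → let (i , j , box , hook≡) = diagonal-sum Su Sv u+v≡
                               in core i j box (subst (t ∣_) (sym hook≡) ∣-refl)
    ; sum≢2+t = λ Su Sv u+v≡ → let (i , j , box , hook≡) = diagonal-sum Su Sv u+v≡
                               in core′ i j box (subst (suc t ∣_) (sym hook≡) ∣-refl)
    }
    where
    positive : ∀ {u} → diagSet xs u ≡ true → 1 ≤ u
    positive Su with diagSet-sound xs Su
    ... | k , diag , refl = m<n⇒0<n∸m diag
    bounded : ∀ {u} → diagSet xs u ≡ true → u ≤ t
    bounded Su with diagSet-sound xs Su
    ... | k , _ , refl = ≤-trans (m∸n≤m (part xs (suc k)) k)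
                                 (≤-trans (part-anti P z≤n) (first-row-≤ P SC decreasing 2≤t core core′))
    sparse : Sparse (diagSet xs)
    sparse {u} Su with diagSet xs (suc u) in S[1+u]
    ... | false = refl
    ... | true with diagSet-sound xs Su | diagSet-sound xs S[1+u]
    ...   | k , dk , refl | l , dl , eq = contradiction eq (diagValue-apart P decreasing dk dl)

  fromSet-diagSet : xs ≡ fromSet (diagSet xs) t
  fromSet-diagSet =
    selfConj-determined-by-diagonal P Pβ SC (fromSet-selfConj S t)
      (λ {k} dk → let (dk′ , same) = xs→β k dk in dk′ , same-diagValue⇒same-part xs β dk dk′ same)
      (λ {k} dk → let (dk′ , same) = β→xs k dk in dk′ , same-diagValue⇒same-part β xs dk dk′ same)
    where
    S : ℕ → Bool
    S = diagSet xs
    β : List ℕ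
    β = fromSet S t
    Pβ : IsPartition β
    Pβ = fromSet-partition S t
    decreasingβ : StrictDiagonal β
    decreasingβ = fromSet-strictDiagonal (Admissible.sparse diagSet-admissible) t

    xs⊆β : ∀ {k} → OnDiagonal xs k → ∃ λ l → OnDiagonal β l × diagValue β l ≡ diagValue xs k
    xs⊆β {k} dk = fromSet-realises S t Sk (m<n⇒0<n∸m dk) (Admissible.bounded diagSet-admissible Sk)
      where
      Sk : S (diagValue xs k) ≡ true
      Sk = diagSet-complete xs dk

    β⊆xs : ∀ {l} → OnDiagonal β l → ∃ λ k → OnDiagonal xs k × diagValue xs k ≡ diagValue β l
    β⊆xs dl = diagSet-sound xs (fromSet-diagValue S t dl)

    xs→β : ∀ k → OnDiagonal xs k → OnDiagonal β k × diagValue xs k ≡ diagValue β k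
    xs→β = decreasing-enumerations-agree (onDiagonal-down P) (onDiagonal-down Pβ)
             (diagValue-< P decreasing) (diagValue-< Pβ decreasingβ) xs⊆β β⊆xs

    β→xs : ∀ k → OnDiagonal β k → OnDiagonal xs k × diagValue β k ≡ diagValue xs k
    β→xs = decreasing-enumerations-agree (onDiagonal-down Pβ) (onDiagonal-down P)
             (diagValue-< Pβ decreasingβ) (diagValue-< P decreasing) β⊆xs xs⊆β


  size≡weight : size xs ≡ weight (diagSet xs) t
  size≡weight = trans (cong size fromSet-diagSet) (fromSet-size (diagSet xs) t)

-- Heavier admissible sets

_[_≔_] : (ℕ → Bool) → ℕ → Bool → ℕ → Bool
(S [ c ≔ b ]) x with x ≟ c
... | yes _ = b
... | no  _ = S x

[≔]-same : ∀ S c b → (S [ c ≔ b ]) c ≡ b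
[≔]-same S c b with c ≟ c
... | yes _   = refl
... | no  c≢c = contradiction refl c≢c

[≔]-other : ∀ S {c} b {x} → x ≢ c → (S [ c ≔ b ]) x ≡ S x
[≔]-other S {c} b {x} x≢c with x ≟ c
... | yes x≡c = contradiction x≡c x≢c
... | no  _   = refl

∈-insert : ∀ S c x → (S [ c ≔ true ]) x ≡ true → x ≡ c ⊎ S x ≡ true
∈-insert S c x member with x ≟ c
... | yes x≡c = inj₁ x≡c
... | no  _   = inj₂ member

∈-remove : ∀ S c x → (S [ c ≔ false ]) x ≡ true → S x ≡ true
∈-remove S c x member with x ≟ c
∈-remove S c x () | yes _
... | no _ = member

∉-remove : ∀ S c x → S x ≡ false → (S [ c ≔ false ]) x ≡ false
∉-remove S c x Sx with x ≟ c
... | yes _ = refl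
... | no  _ = Sx

weight-cong : ∀ {S S′} n → (∀ {x} → 1 ≤ x → x ≤ n → S x ≡ S′ x) → weight S n ≡ weight S′ n
weight-cong zero    _    = refl
weight-cong (suc n) same = cong₂ _+_ (cong (λ b → diagHookIf b (suc n)) (same (s≤s z≤n) ≤-refl))
                                     (weight-cong n (λ 1≤x x≤n → same 1≤x (m≤n⇒m≤1+n x≤n)))

diagHookIf-0 : ∀ b → diagHookIf b 0 ≡ 0
diagHookIf-0 true  = refl
diagHookIf-0 false = refl

weight-update : ∀ S c b n → c ≤ n → weight (S [ c ≔ b ]) n + diagHookIf (S c) c ≡ weight S n + diagHookIf b c
weight-update S c b zero z≤n = trans (diagHookIf-0 (S 0)) (sym (diagHookIf-0 b))
weight-update S c b (suc n) c≤1+n with c ≟ suc n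
... | yes refl = begin
  diagHookIf ((S [ c ≔ b ]) c) c + weight (S [ c ≔ b ]) n + diagHookIf (S c) c
    ≡⟨ cong₂ (λ b′ w → diagHookIf b′ c + w + diagHookIf (S c) c)
             ([≔]-same S c b) (weight-cong n λ _ x≤n → [≔]-other S b (<⇒≢ (s≤s x≤n))) ⟩
  diagHookIf b c + weight S n + diagHookIf (S c) c
    ≡⟨ swap-outer (diagHookIf b c) (weight S n) (diagHookIf (S c) c) ⟩
  diagHookIf (S c) c + weight S n + diagHookIf b c ∎
  where
  open ≡-Reasoning
  swap-outer : ∀ x y z → x + y + z ≡ z + y + x
  swap-outer = solve-∀
... | no c≢1+n = begin
  diagHookIf ((S [ c ≔ b ]) (suc n)) (suc n) + weight (S [ c ≔ b ]) n + diagHookIf (S c) c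
    ≡⟨ +-assoc (diagHookIf ((S [ c ≔ b ]) (suc n)) (suc n)) _ _ ⟩
  diagHookIf ((S [ c ≔ b ]) (suc n)) (suc n) + (weight (S [ c ≔ b ]) n + diagHookIf (S c) c)
    ≡⟨ cong₂ (λ b′ w → diagHookIf b′ (suc n) + w)
             ([≔]-other S b (c≢1+n ∘ sym)) (weight-update S c b n (s≤s⁻¹ (≤∧≢⇒< c≤1+n c≢1+n))) ⟩
  diagHookIf (S (suc n)) (suc n) + (weight S n + diagHookIf b c)
    ≡⟨ +-assoc (diagHookIf (S (suc n)) (suc n)) _ _ ⟨
  diagHookIf (S (suc n)) (suc n) + weight S n + diagHookIf b c ∎
  where open ≡-Reasoning

weight-insert : ∀ {S c} n → S c ≡ false → c ≤ n → weight (S [ c ≔ true ]) n ≡ weight S n + diagHook c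
weight-insert {S} {c} n Sc c≤n = begin
  weight (S [ c ≔ true ]) n                      ≡⟨ +-identityʳ _ ⟨
  weight (S [ c ≔ true ]) n + diagHookIf false c ≡⟨ cong (λ b → weight (S [ c ≔ true ]) n + diagHookIf b c) Sc ⟨
  weight (S [ c ≔ true ]) n + diagHookIf (S c) c ≡⟨ weight-update S c true n c≤n ⟩
  weight S n + diagHook c                        ∎
  where open ≡-Reasoning

weight-remove : ∀ S c n → c ≤ n → weight S n ≡ weight (S [ c ≔ false ]) n + diagHookIf (S c) c
weight-remove S c n c≤n = sym (trans (weight-update S c false n c≤n) (+-identityʳ _))

diagHook-mono-< : ∀ {m n} → m < n → diagHook m < diagHook n
diagHook-mono-< m<n = +-mono-<-≤ m<n (pred-mono-≤ (<⇒≤ m<n))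

diagHookIf≤diagHook : ∀ b u → diagHookIf b u ≤ diagHook u
diagHookIf≤diagHook true  u = ≤-refl
diagHookIf≤diagHook false u = z≤n

module _ {t : ℕ} {S g : ℕ → Bool} (A : Admissible t S) (New : ℕ → Set)
         (old-or-new : ∀ {w} → g w ≡ true → S w ≡ true ⊎ New w)
         (new-positive : ∀ {w} → New w → 1 ≤ w) (new-bounded : ∀ {w} → New w → w ≤ t)
         (after-new : ∀ {w} → New w → g (suc w) ≡ false) (before-new : ∀ {w} → New (suc w) → g w ≡ false)
         (partners-absent : ∀ {u v} → New u → u + v ≡ suc t ⊎ u + v ≡ suc (suc t) → g v ≡ false)
         where
  private module A = Admissible A

  admissible-modified : Admissible t g
  admissible-modified = record
    { positive = [ A.positive , new-positive ]′ ∘ old-or-new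
    ; bounded  = [ A.bounded , new-bounded ]′ ∘ old-or-new
    ; sparse   = sparse
    ; sum≢1+t  = λ gu gv → sums gu gv ∘ inj₁
    ; sum≢2+t  = λ gu gv → sums gu gv ∘ inj₂
    }
    where
    sparse : Sparse g
    sparse {w} gw with old-or-new gw | g (suc w) in g[1+w]
    ... | _        | false = refl
    ... | inj₂ new | true  = ⊥-elim (not-¬ g[1+w] (after-new new))
    ... | inj₁ Sw  | true  with old-or-new g[1+w]
    ...   | inj₁ S[1+w] = ⊥-elim (not-¬ S[1+w] (A.sparse Sw))
    ...   | inj₂ new    = ⊥-elim (not-¬ gw (before-new new))

    sums : ∀ {u v} → g u ≡ true → g v ≡ true → ¬ (u + v ≡ suc t ⊎ u + v ≡ suc (suc t))
    sums {u} {v} gu gv sum with old-or-new gu | old-or-new gv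
    ... | inj₂ new | _        = not-¬ gv (partners-absent new sum)
    ... | inj₁ _   | inj₂ new = not-¬ gu (partners-absent new (Sum.map (trans (+-comm v u)) (trans (+-comm v u)) sum))
    ... | inj₁ Su  | inj₁ Sv  = [ A.sum≢1+t Su Sv , A.sum≢2+t Su Sv ]′ sum

diagHookIf-pair : ∀ {S} → Sparse S → ∀ p → diagHookIf (S (suc p)) (suc p) + diagHookIf (S p) p ≤ diagHook (suc p)
diagHookIf-pair {S} sparse p with S p in Sp
... | true  = subst (λ b → diagHookIf b (suc p) + diagHook p ≤ diagHook (suc p)) (sym (sparse Sp))
                    (<⇒≤ (diagHook-mono-< (n<1+n p)))
... | false = ≤-trans (≤-reflexive (+-identityʳ _)) (diagHookIf≤diagHook (S (suc p)) (suc p))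

Heavier : ℕ → (ℕ → Bool) → Set
Heavier t S = ∃ λ g → Admissible t g × weight S t < weight g t

-- Here b < a = c + 2 are consecutive elements of S.
module Improvement {t : ℕ} {S : ℕ → Bool} (A : Admissible t S) {b c : ℕ}
                   (Sb : S b ≡ true) (Sa : S (suc (suc c)) ≡ true) (b+2≤c : 2 + b ≤ c)
                   (between : ∀ {w} → b < w → w < suc (suc c) → S w ≡ false) where
  private
    module A = Admissible A

    b<c : b < c
    b<c = ≤-trans (n≤1+n (suc b)) b+2≤c

    c≤t : c ≤ t
    c≤t = ≤-trans (≤-trans (n≤1+n c) (n≤1+n (suc c))) (A.bounded Sa)

    S-c : S c ≡ false
    S-c = between b<c (≤-trans (n<1+n c) (n≤1+n (suc c)))

    S-1+c : S (suc c) ≡ false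
    S-1+c = between (≤-trans b<c (n≤1+n c)) ≤-refl

    b<2+b : b < suc (suc b)
    b<2+b = m<n+m b z<s

    S-2+b : S (suc (suc b)) ≡ false
    S-2+b = between b<2+b (s≤s (s≤s b<c))

  -- p and p + 1 are the partners of c; at most one of them lies in S, and both are below c.
  module AddC {p} (p+c≡1+t : p + c ≡ suc t) (big : t + 3 ≤ c + c) where
    S₁ S₂ g : ℕ → Bool
    S₁ = S [ p ≔ false ]
    S₂ = S₁ [ suc p ≔ false ]
    g  = S₂ [ c ≔ true ]

    p+2≤c : p + 2 ≤ c
    p+2≤c = +-cancelʳ-≤ c (p + 2) c (begin
      p + 2 + c ≡⟨ swap p 2 c ⟩
      p + c + 2 ≡⟨ cong (_+ 2) p+c≡1+t ⟩
      suc t + 2 ≡⟨ +-suc t 2 ⟨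
      t + 3     ≤⟨ big ⟩
      c + c     ∎)
      where
      open ≤-Reasoning
      swap : ∀ p a c → p + a + c ≡ p + c + a
      swap = solve-∀

    c+p≡1+t : c + p ≡ suc t
    c+p≡1+t = trans (+-comm c p) p+c≡1+t

    p<c : p < c
    p<c = ≤-trans (≤-trans (n≤1+n (suc p)) (≤-reflexive (+-comm 2 p))) p+2≤c

    1+p<c : suc p < c
    1+p<c = ≤-trans (≤-reflexive (+-comm 2 p)) p+2≤c

    g-absent : ∀ {y} → y ≢ c → S y ≡ false → g y ≡ false
    g-absent {y} y≢c Sy = trans ([≔]-other S₂ true y≢c) (∉-remove S₁ (suc p) y (∉-remove S p y Sy))

    g-p : g p ≡ false
    g-p = trans ([≔]-other S₂ true (<⇒≢ p<c)) (trans ([≔]-other S₁ false (<⇒≢ (n<1+n p))) ([≔]-same S p false))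

    g-1+p : g (suc p) ≡ false
    g-1+p = trans ([≔]-other S₂ true (<⇒≢ 1+p<c)) ([≔]-same S₁ (suc p) false)

    old-or-new : ∀ {w} → g w ≡ true → S w ≡ true ⊎ w ≡ c
    old-or-new {w} gw = [ inj₂ , inj₁ ∘ ∈-remove S p w ∘ ∈-remove S₁ (suc p) w ]′ (∈-insert S₂ c w gw)

    after-new : ∀ {w} → w ≡ c → g (suc w) ≡ false
    after-new refl = g-absent (1+n≢n) S-1+c

    before-new : ∀ {w} → suc w ≡ c → g w ≡ false
    before-new {w} 1+w≡c = g-absent (<⇒≢ (≤-reflexive 1+w≡c)) (between b<w w<a)
      where
      b<w : b < w
      b<w = s≤s⁻¹ (≤-trans b+2≤c (≤-reflexive (sym 1+w≡c)))
      w<a : w < suc (suc c)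
      w<a = ≤-trans (≤-reflexive 1+w≡c) (m≤n+m c 2)

    partners-absent : ∀ {u v} → u ≡ c → u + v ≡ suc t ⊎ u + v ≡ suc (suc t) → g v ≡ false
    partners-absent {v = v} refl (inj₁ c+v≡1+t) = subst (λ y → g y ≡ false) (sym v≡p) g-p
      where
      v≡p : v ≡ p
      v≡p = +-cancelˡ-≡ c v p (trans c+v≡1+t (sym c+p≡1+t))
    partners-absent {v = v} refl (inj₂ c+v≡2+t) = subst (λ y → g y ≡ false) (sym v≡1+p) g-1+p
      where
      v≡1+p : v ≡ suc p
      v≡1+p = +-cancelˡ-≡ c v (suc p) (trans c+v≡2+t (sym (trans (+-suc c p) (cong suc c+p≡1+t))))

    heavier : weight S t < weight g t
    heavier = begin-strict
      weight S t
        ≡⟨ weight-remove S p t p≤t ⟩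
      weight S₁ t + diagHookIf (S p) p
        ≡⟨ cong (_+ diagHookIf (S p) p) (weight-remove S₁ (suc p) t (<⇒≤ 1+p<t)) ⟩
      weight S₂ t + diagHookIf (S₁ (suc p)) (suc p) + diagHookIf (S p) p
        ≡⟨ +-assoc (weight S₂ t) _ _ ⟩
      weight S₂ t + (diagHookIf (S₁ (suc p)) (suc p) + diagHookIf (S p) p)
        ≡⟨ cong (λ b′ → weight S₂ t + (diagHookIf b′ (suc p) + diagHookIf (S p) p)) ([≔]-other S false (1+n≢n {p})) ⟩
      weight S₂ t + (diagHookIf (S (suc p)) (suc p) + diagHookIf (S p) p)
        ≤⟨ +-monoʳ-≤ (weight S₂ t) (diagHookIf-pair {S} A.sparse p) ⟩
      weight S₂ t + diagHook (suc p)
        <⟨ +-monoʳ-< (weight S₂ t) (diagHook-mono-< 1+p<c) ⟩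
      weight S₂ t + diagHook c
        ≡⟨ weight-insert t (∉-remove S₁ (suc p) c (∉-remove S p c S-c)) c≤t ⟨
      weight g t ∎
      where
      open ≤-Reasoning
      1+p<t : suc p < t
      1+p<t = ≤-trans 1+p<c c≤t
      p≤t : p ≤ t
      p≤t = ≤-trans (<⇒≤ p<c) c≤t

    add-c : Heavier t S
    add-c = g , admissible-modified A (_≡ c) old-or-new
                  (λ { refl → ≤-trans (s≤s z≤n) b<c }) (λ { refl → c≤t })
                  after-new before-new partners-absent , heavier

  module _ (small : c + c ≤ t + 2) where
    private
      b+b+2≤t : b + b + 2 ≤ t
      b+b+2≤t = +-cancelʳ-≤ 2 (b + b + 2) t (begin
        b + b + 2 + 2     ≡⟨ regroup b ⟩
        (2 + b) + (2 + b) ≤⟨ +-mono-≤ b+2≤c b+2≤c ⟩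
        c + c             ≤⟨ small ⟩
        t + 2             ∎)
        where
        open ≤-Reasoning
        regroup : ∀ b → b + b + 2 + 2 ≡ (2 + b) + (2 + b)
        regroup = solve-∀

      b+1+b<t : b + suc b < t
      b+1+b<t = ≤-trans (≤-reflexive (regroup b)) b+b+2≤t
        where
        regroup : ∀ b → suc (b + suc b) ≡ b + b + 2
        regroup = solve-∀

      b<t : b < t
      b<t = ≤-trans b<c c≤t

    module ShiftB (no-partner : ∀ {w} → S w ≡ true → b + w ≢ t) where
      S₁ g : ℕ → Bool
      S₁ = S [ b ≔ false ]
      g  = S₁ [ suc b ≔ true ]

      g-absent : ∀ {y} → y ≢ suc b → S₁ y ≡ false → g y ≡ false
      g-absent y≢1+b S₁y = trans ([≔]-other S₁ true y≢1+b) S₁y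

      not-1+b : ∀ {v} → t ≤ b + v → v ≢ suc b
      not-1+b t≤b+v refl = <⇒≱ b+1+b<t t≤b+v

      old-or-new : ∀ {w} → g w ≡ true → S w ≡ true ⊎ w ≡ suc b
      old-or-new {w} gw = [ inj₂ , inj₁ ∘ ∈-remove S b w ]′ (∈-insert S₁ (suc b) w gw)

      after-new : ∀ {w} → w ≡ suc b → g (suc w) ≡ false
      after-new refl = g-absent 1+n≢n (∉-remove S b (suc (suc b)) S-2+b)

      before-new : ∀ {w} → suc w ≡ suc b → g w ≡ false
      before-new 1+w≡1+b rewrite suc-injective 1+w≡1+b = g-absent (<⇒≢ (n<1+n b)) ([≔]-same S b false)

      partners-absent : ∀ {u v} → u ≡ suc b → u + v ≡ suc t ⊎ u + v ≡ suc (suc t) → g v ≡ false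
      partners-absent {v = v} refl (inj₁ 1+b+v≡1+t) =
        g-absent (not-1+b (≤-reflexive (sym b+v≡t))) (∉-remove S b v (¬-not λ Sv → no-partner Sv b+v≡t))
        where
        b+v≡t : b + v ≡ t
        b+v≡t = suc-injective 1+b+v≡1+t
      partners-absent {v = v} refl (inj₂ 1+b+v≡2+t) =
        g-absent (not-1+b (≤-trans (n≤1+n t) (≤-reflexive (sym b+v≡1+t))))
                 (∉-remove S b v (¬-not λ Sv → A.sum≢1+t Sb Sv b+v≡1+t))
        where
        b+v≡1+t : b + v ≡ suc t
        b+v≡1+t = suc-injective 1+b+v≡2+t

      heavier : weight S t < weight g t
      heavier = begin-strict
        weight S t                        ≡⟨ weight-remove S b t (<⇒≤ b<t) ⟩
        weight S₁ t + diagHookIf (S b) b  ≡⟨ cong (λ b′ → weight S₁ t + diagHookIf b′ b) Sb ⟩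
        weight S₁ t + diagHook b          <⟨ +-monoʳ-< (weight S₁ t) (diagHook-mono-< (n<1+n b)) ⟩
        weight S₁ t + diagHook (suc b)    ≡⟨ weight-insert t (∉-remove S b (suc b) (A.sparse Sb)) b<t ⟨
        weight g t                        ∎
        where open ≤-Reasoning

      shift-b : Heavier t S
      shift-b = g , admissible-modified A (_≡ suc b) old-or-new (λ { refl → s≤s z≤n }) (λ { refl → b<t })
                      after-new before-new partners-absent , heavier

    module ShiftBAndPartner {x} (Sx : S x ≡ true) (b+x≡t : b + x ≡ t) where
      S₁ S₂ S₃ g : ℕ → Bool
      S₁ = S [ b ≔ false ]
      S₂ = S₁ [ suc (suc b) ≔ true ]
      S₃ = S₂ [ x ≔ false ]
      g  = S₃ [ suc x ≔ true ]

      New : ℕ → Set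
      New w = w ≡ suc (suc b) ⊎ w ≡ suc x

      b+2≤x : 2 + b ≤ x
      b+2≤x = +-cancelˡ-≤ b (2 + b) x (begin
        b + (2 + b) ≡⟨ regroup b ⟩
        b + b + 2   ≤⟨ b+b+2≤t ⟩
        t           ≡⟨ b+x≡t ⟨
        b + x       ∎)
        where
        open ≤-Reasoning
        regroup : ∀ b → b + (2 + b) ≡ b + b + 2
        regroup = solve-∀

      b<x : b < x
      b<x = ≤-trans (n≤1+n (suc b)) b+2≤x

      b+4≤x : 4 + b ≤ x
      b+4≤x = ≤-trans (s≤s (s≤s b+2≤c)) (≮⇒≥ λ x<a → not-¬ Sx (between b<x x<a))

      b+3≤x : 3 + b ≤ x
      b+3≤x = ≤-trans (n≤1+n (3 + b)) b+4≤x

      1+x≤t : suc x ≤ t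
      1+x≤t = ≤-trans (+-monoˡ-≤ x (A.positive Sb)) (≤-reflexive b+x≡t)

      2+b≤t : 2 + b ≤ t
      2+b≤t = ≤-trans (≤-trans b+2≤x (n≤1+n x)) 1+x≤t

      g-absent : ∀ {y} → y ≢ suc (suc b) → y ≢ suc x → S₁ y ≡ false → g y ≡ false
      g-absent {y} y≢2+b y≢1+x S₁y =
        trans ([≔]-other S₃ true y≢1+x) (∉-remove S₂ x y (trans ([≔]-other S₁ true y≢2+b) S₁y))

      g-b : g b ≡ false
      g-b = g-absent (<⇒≢ b<2+b) (<⇒≢ (≤-trans b<x (n≤1+n x))) ([≔]-same S b false)

      g-1+b : g (suc b) ≡ false
      g-1+b = g-absent (<⇒≢ (n<1+n (suc b))) (<⇒≢ (s≤s b<x)) (∉-remove S b (suc b) (A.sparse Sb))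

      g-x : g x ≡ false
      g-x = trans ([≔]-other S₃ true (<⇒≢ (n<1+n x))) ([≔]-same S₂ x false)

      g-before-x : ∀ {v} → suc v ≡ x → g v ≡ false
      g-before-x {v} 1+v≡x = g-absent (>⇒≢ (s≤s⁻¹ (≤-trans b+4≤x (≤-reflexive (sym 1+v≡x)))))
                                      (<⇒≢ (≤-trans (≤-reflexive 1+v≡x) (n≤1+n x)))
                                      (∉-remove S b v Sv)
        where
        Sv : S v ≡ false
        Sv = ¬-not λ Sv → not-¬ Sx (subst (λ y → S y ≡ false) 1+v≡x (A.sparse Sv))

      g-3+b : g (3 + b) ≡ false
      g-3+b = g-absent (>⇒≢ (n<1+n (suc (suc b)))) (<⇒≢ (s≤s b+3≤x))
                       (∉-remove S b (3 + b) (between (m<n+m b z<s) (s≤s (s≤s b+2≤c))))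

      g-2+x : g (2 + x) ≡ false
      g-2+x = g-absent (>⇒≢ (s≤s (s≤s b<x))) (>⇒≢ (n<1+n (suc x)))
                       (∉-remove S b (2 + x) (¬-not λ S[2+x] → A.sum≢2+t Sb S[2+x] b+2+x≡2+t))
        where
        b+2+x≡2+t : b + suc (suc x) ≡ suc (suc t)
        b+2+x≡2+t = trans (+-suc b (suc x)) (cong suc (trans (+-suc b x) (cong suc b+x≡t)))

      old-or-new : ∀ {w} → g w ≡ true → S w ≡ true ⊎ New w
      old-or-new {w} gw =
        [ inj₂ ∘ inj₂
        , [ inj₂ ∘ inj₁ , inj₁ ∘ ∈-remove S b w ]′ ∘ ∈-insert S₁ (suc (suc b)) w ∘ ∈-remove S₂ x w
        ]′ (∈-insert S₃ (suc x) w gw)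

      after-new : ∀ {w} → New w → g (suc w) ≡ false
      after-new (inj₁ refl) = g-3+b
      after-new (inj₂ refl) = g-2+x

      before-new : ∀ {w} → New (suc w) → g w ≡ false
      before-new (inj₁ 1+w≡2+b) rewrite suc-injective 1+w≡2+b = g-1+b
      before-new (inj₂ 1+w≡1+x) rewrite suc-injective 1+w≡1+x = g-x

      partners-absent : ∀ {u v} → New u → u + v ≡ suc t ⊎ u + v ≡ suc (suc t) → g v ≡ false
      x+b≡t : x + b ≡ t
      x+b≡t = trans (+-comm x b) b+x≡t

      partners-absent {v = v} (inj₁ refl) (inj₁ sum) =
        g-before-x (+-cancelˡ-≡ b (suc v) x (trans (+-suc b v) (trans (suc-injective sum) (sym b+x≡t))))
      partners-absent {v = v} (inj₁ refl) (inj₂ sum) =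
        subst (λ y → g y ≡ false) (sym (+-cancelˡ-≡ b v x (trans (suc-injective (suc-injective sum)) (sym b+x≡t))))
              g-x
      partners-absent {v = v} (inj₂ refl) (inj₁ sum) =
        subst (λ y → g y ≡ false) (sym (+-cancelˡ-≡ x v b (trans (suc-injective sum) (sym x+b≡t)))) g-b
      partners-absent {v = v} (inj₂ refl) (inj₂ sum) =
        subst (λ y → g y ≡ false) (sym (+-cancelˡ-≡ x v (suc b) (trans sum′ (sym (trans (+-suc x b) (cong suc x+b≡t))))))
              g-1+b
        where
        sum′ : x + v ≡ suc t
        sum′ = suc-injective sum

      heavier : weight S t < weight g t
      heavier = begin-strict
        weight S t                              ≡⟨ weight-remove S b t (<⇒≤ (≤-trans b<2+b 2+b≤t)) ⟩
        weight S₁ t + diagHookIf (S b) b        ≡⟨ cong (λ b′ → weight S₁ t + diagHookIf b′ b) Sb ⟩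
        weight S₁ t + diagHook b                <⟨ +-monoʳ-< (weight S₁ t) (diagHook-mono-< b<2+b) ⟩
        weight S₁ t + diagHook (suc (suc b))    ≡⟨ weight-insert t (∉-remove S b (suc (suc b)) S-2+b) 2+b≤t ⟨
        weight S₂ t                             ≡⟨ weight-remove S₂ x t (≤-trans (n≤1+n x) 1+x≤t) ⟩
        weight S₃ t + diagHookIf (S₂ x) x       ≡⟨ cong (λ b′ → weight S₃ t + diagHookIf b′ x) S₂x ⟩
        weight S₃ t + diagHook x                <⟨ +-monoʳ-< (weight S₃ t) (diagHook-mono-< (n<1+n x)) ⟩
        weight S₃ t + diagHook (suc x)          ≡⟨ weight-insert t S₃[1+x] 1+x≤t ⟨
        weight g t                              ∎
        where
        open ≤-Reasoning
        S₂x : S₂ x ≡ true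
        S₂x = trans ([≔]-other S₁ true (>⇒≢ b+3≤x)) (trans ([≔]-other S false (>⇒≢ b<x)) Sx)
        S₃[1+x] : S₃ (suc x) ≡ false
        S₃[1+x] = ∉-remove S₂ x (suc x)
                    (trans ([≔]-other S₁ true (>⇒≢ (s≤s b+2≤x))) (∉-remove S b (suc x) (A.sparse Sx)))

      shift-b-and-partner : Heavier t S
      shift-b-and-partner =
        g , admissible-modified A New old-or-new
              [ (λ { refl → s≤s z≤n }) , (λ { refl → s≤s z≤n }) ]′ [ (λ { refl → 2+b≤t }) , (λ { refl → 1+x≤t }) ]′
              after-new before-new partners-absent , heavier

    shift : Heavier t S
    shift with S (t ∸ b) in S[t∸b]
    ... | true  = ShiftBAndPartner.shift-b-and-partner S[t∸b] (m+[n∸m]≡n (<⇒≤ b<t))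
    ... | false = ShiftB.shift-b λ Sw b+w≡t → not-¬ Sw (subst (λ y → S y ≡ false) (sym (w≡t∸b b+w≡t)) S[t∸b])
      where
      w≡t∸b : ∀ {w} → b + w ≡ t → w ≡ t ∸ b
      w≡t∸b {w} b+w≡t = trans (sym (m+n∸m≡n b w)) (cong (_∸ b) b+w≡t)

  improve : Heavier t S
  improve with t + 3 ≤? c + c
  ... | yes big   = AddC.add-c (m∸n+n≡m (m≤n⇒m≤1+n c≤t)) big
  ... | no  ¬big  = shift (s≤s⁻¹ (≤-trans (≰⇒> ¬big) (≤-reflexive (+-suc t 2))))

Heaviest : ℕ → (ℕ → Bool) → Set
Heaviest t S = ∀ {g} → Admissible t g → weight g t ≤ weight S t

heaviest-gap : ∀ {t S a b} → Admissible t S → Heaviest t S → S a ≡ true → S b ≡ true →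
               (∀ {w} → b < w → w < a → S w ≡ false) → ¬ (3 + b < a)
heaviest-gap A heaviest Sa Sb between (s≤s (s≤s b+2≤c)) =
  let (g , Ag , heavier) = Improvement.improve A Sb Sa b+2≤c between in <⇒≱ heavier (heaviest Ag)

sparse-gap : ∀ {S a b} → Sparse S → S a ≡ true → S b ≡ true → b < a → 2 + b ≤ a
sparse-gap {S} sparse Sa Sb b<a = ≤∧≢⇒< b<a λ 1+b≡a → not-¬ Sa (subst (λ y → S y ≡ false) 1+b≡a (sparse Sb))

heaviest-consecutive-gap : ∀ {t S a b} → Admissible t S → Heaviest t S → S a ≡ true → S b ≡ true → b < a →
                           (∀ {w} → b < w → w < a → S w ≡ false) → 2 + b ≤ a × a ≤ 3 + b
heaviest-consecutive-gap A heaviest Sa Sb b<a between =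
  sparse-gap (Admissible.sparse A) Sa Sb b<a , ≮⇒≥ (heaviest-gap A heaviest Sa Sb between)

module _ {xs : List ℕ} (P : IsPartition xs) (SC : SelfConj xs) where

  ∈MD⇒diagSet : ∀ {h} → h ∈MD xs → ∃ λ u → diagSet xs u ≡ true × suc h ≡ u + u
  ∈MD⇒diagSet (suc k , _ , k<s , refl) = diagValue xs k , diagSet-complete xs diag , hook-diagonal P SC diag diag
    where
    diag : OnDiagonal xs k
    diag = ≤s⇒onDiagonal P k<s

  diagSet⇒∈MD : ∀ {u} → diagSet xs u ≡ true → ∃ λ h → h ∈MD xs × suc h ≡ u + u
  diagSet⇒∈MD Su with diagSet-sound xs Su
  ... | k , diag , refl =
    hook xs (suc k) (suc k) , (suc k , s≤s z≤n , onDiagonal⇒≤s P diag , refl) , hook-diagonal P SC diag diag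

halves-< : ∀ {h h′ u u′} → suc h ≡ u + u → suc h′ ≡ u′ + u′ → h < h′ → u < u′
halves-< 1+h≡ 1+h′≡ h<h′ = ≰⇒> λ u′≤u → <⇒≱ h<h′ (s≤s⁻¹ (subst₂ _≤_ (sym 1+h′≡) (sym 1+h≡) (+-mono-≤ u′≤u u′≤u)))

double-< : ∀ {h h′ u u′} → suc h ≡ u + u → suc h′ ≡ u′ + u′ → u < u′ → h < h′
double-< 1+h≡ 1+h′≡ u<u′ = s≤s⁻¹ (subst₂ _<_ (sym 1+h≡) (sym 1+h′≡) (+-mono-< u<u′ u<u′))

double-gap : ∀ {a b u v} → suc a ≡ u + u → suc b ≡ v + v → 2 + v ≤ u × u ≤ 3 + v → 4 ≤ a ∸ b × a ∸ b ≤ 6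
double-gap {a} {b} {u} {v} 1+a≡ 1+b≡ (lower , upper) =
  m+n≤o⇒m≤o∸n 4 (s≤s⁻¹ (begin
    suc (4 + b)       ≡⟨ cong (4 +_) 1+b≡ ⟩
    4 + (v + v)       ≡⟨ regroup v ⟩
    (2 + v) + (2 + v) ≤⟨ +-mono-≤ lower lower ⟩
    u + u             ≡⟨ 1+a≡ ⟨
    suc a             ∎)) ,
  m≤n+o⇒m∸n≤o a b (s≤s⁻¹ (begin
    suc a             ≡⟨ 1+a≡ ⟩
    u + u             ≤⟨ +-mono-≤ upper upper ⟩
    (3 + v) + (3 + v) ≡⟨ regroup′ v ⟩
    6 + (v + v)       ≡⟨ cong (6 +_) 1+b≡ ⟨
    6 + suc b         ≡⟨ +-comm 6 (suc b) ⟩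
    suc (b + 6)       ∎))
  where
  open ≤-Reasoning
  regroup : ∀ v → 4 + (v + v) ≡ (2 + v) + (2 + v)
  regroup = solve-∀
  regroup′ : ∀ v → (3 + v) + (3 + v) ≡ 6 + (v + v)
  regroup′ = solve-∀

lemma3p2 : (t : ℕ) → 6 ≤ t → (λ′ : List ℕ) → DS t λ′
    → ((μ : List ℕ) → DS t μ → size μ ≤ size λ′)
    → (a b : ℕ) → a ∈MD λ′ → b ∈MD λ′ → b < a
    → ((c : ℕ) → c ∈MD λ′ → b < c → c < a → ⊥)
    → 4 ≤ a ∸ b × a ∸ b ≤ 6
lemma3p2 t 6≤t λ′ ds maximal a b a∈MD b∈MD b<a nothing-between =
  let (u , Su , 1+a≡) = ∈MD⇒diagSet P SC a∈MD
      (v , Sv , 1+b≡) = ∈MD⇒diagSet P SC b∈MD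
  in double-gap 1+a≡ 1+b≡
       (heaviest-consecutive-gap A heaviest Su Sv (halves-< 1+b≡ 1+a≡ b<a) (no-value-between 1+a≡ 1+b≡))
  where
  P : IsPartition λ′
  P = proj₁ ds
  SC : SelfConj λ′
  SC = proj₁ (proj₂ (proj₂ (proj₂ ds)))
  2≤t : 2 ≤ t
  2≤t = ≤-trans (s≤s (s≤s z≤n)) 6≤t
  A : Admissible t (diagSet λ′)
  A = diagSet-admissible 2≤t ds

  heaviest : Heaviest t (diagSet λ′)
  heaviest {g} Ag = begin
    weight g t            ≡⟨ fromSet-size g t ⟨
    size (fromSet g t)    ≤⟨ maximal (fromSet g t) (fromSet-DS Ag) ⟩
    size λ′               ≡⟨ size≡weight 2≤t ds ⟩
    weight (diagSet λ′) t ∎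
    where open ≤-Reasoning

  no-value-between : ∀ {u v} → suc a ≡ u + u → suc b ≡ v + v → ∀ {w} → v < w → w < u → diagSet λ′ w ≡ false
  no-value-between 1+a≡ 1+b≡ v<w w<u = ¬-not λ Sw → let (h , h∈MD , 1+h≡) = diagSet⇒∈MD P SC Sw in
    nothing-between h h∈MD (double-< 1+b≡ 1+h≡ v<w) (double-< 1+h≡ 1+a≡ w<u)
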